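{- Let $T$ be a tree on $n$ vertices with diameter $D\geq 5$ and let $P=v_0v_1\ldots v_D$ be a diametric path such that $M(v_2)/\deg(v_1)\leq M(v_{D-2})/\deg(v_{D-1})$. Let $w_1,\ldots,w_k$ be all pendant vertices (leaves) adjacent to $v_1$. Let $T'$ be the tree obtained from $T$ by deleting the edges $v_1w_1,\ldots,v_1w_k$ and adding the edges $v_{D-1}w_1,\ldots,v_{D-1}w_k$. Then $\xi^{ac}(T)<\xi^{ac}(T')$.
   Context: $d(u,v)$ is the distance, $\varepsilon(u)=\max_v d(u,v)$ the eccentricity, and the diameter $D$ the maximum distance in the tree; a path $v_0\ldots v_D$ with $d(v_0,v_D)=D$ is diametric. $\deg(u)$ is the degree of $u$, $M(u)$ is the product of the degrees of all neighbors of $u$, and $\xi^{ac}(G)=\sum_{u\in V(G)}\frac{M(u)}{\varepsilon(u)}$. -}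

module Defs where

import Data.Nat
open import Data.Nat using (ℕ; zero; suc; _+_; _*_; _∸_; _⊔_; _<_; _≤_)
open import Data.Bool using (Bool; true; false; if_then_else_; _∧_; _∨_; not)
open import Data.Fin using (Fin; _≟_)
open import Data.List using (List; map; foldr; allFin)
open import Data.Bool.ListAction using (any)
open import Data.Nat.ListAction using (sum; product)
open import Data.Empty using (⊥)
open import Data.Integer using (+_)
open import Data.Rational using (ℚ; 0ℚ; _/_)
import Data.Rational as ℚ
open import Relation.Nullary.Decidable using (⌊_⌋)
open import Relation.Binary.PropositionalEquality using (_≡_)

Graph : ℕ → Set
Graph n = Fin n → Fin n → Bool

module _ {n : ℕ} (adj : Graph n) where

  data Walk : Fin n → Fin n → Set where
    here : ∀ {u} → Walk u u
    step : ∀ {u w v} → adj u w ≡ true → Walk w v → Walk u v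

  Symmetric : Set
  Symmetric = ∀ u v → adj u v ≡ adj v u

  Irreflexive : Set
  Irreflexive = ∀ u → adj u u ≡ false

  Connected : Set
  Connected = ∀ u v → Walk u v

  record Cycle : Set where
    field
      len      : ℕ
      len≥3    : 3 ≤ len
      c        : ℕ → Fin n
      distinct : ∀ i j → i < len → j < len → c i ≡ c j → i ≡ j
      consec   : ∀ i → suc i < len → adj (c i) (c (suc i)) ≡ true
      close    : adj (c (len ∸ 1)) (c 0) ≡ true

  Acyclic : Set
  Acyclic = Cycle → ⊥

  record IsTree : Set where
    field
      symmetric   : Symmetric
      irreflexive : Irreflexive
      connected   : Connected
      acyclic     : Acyclic

  reach : ℕ → Fin n → Fin n → Bool
  reach zero    u v = ⌊ u ≟ v ⌋
  reach (suc k) u v = reach k u v ∨ any (λ w → reach k u w ∧ adj w v) (allFin n)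

  -- distance: least k with reach k u v (searched up to n; graphs here are connected)
  distFrom : Fin n → Fin n → ℕ → ℕ → ℕ
  distFrom u v k zero    = k
  distFrom u v k (suc f) = if reach k u v then k else distFrom u v (suc k) f

  dist : Fin n → Fin n → ℕ
  dist u v = distFrom u v 0 n

  ecc : Fin n → ℕ
  ecc u = foldr _⊔_ 0 (map (dist u) (allFin n))

  diameter : ℕ
  diameter = foldr _⊔_ 0 (map ecc (allFin n))

  deg : Fin n → ℕ
  deg u = sum (map (λ v → if adj u v then 1 else 0) (allFin n))

  M : Fin n → ℕ
  M u = product (map (λ v → if adj u v then deg v else 1) (allFin n))

-- m / d as a rational (d = 0 never occurs in the uses below; returns 0 then)
frac : ℕ → ℕ → ℚ
frac m zero    = 0ℚ
frac m (suc d) = (+ m) / suc d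

ξac : ∀ {n} → Graph n → ℚ
ξac {n} adj = foldr ℚ._+_ 0ℚ (map (λ u → frac (M adj u) (ecc adj u)) (allFin n))

pendantAt : ∀ {n} → Graph n → Fin n → Fin n → Bool
pendantAt adj a w = adj a w ∧ ⌊ deg adj w Data.Nat.≟ 1 ⌋

-- delete edges a w for all pendant w adjacent to a, add edges b w
move : ∀ {n} → Graph n → Fin n → Fin n → Graph n
move adj a b x y =
  (adj x y ∧ not ((⌊ x ≟ a ⌋ ∧ pendantAt adj a y) ∨ (⌊ y ≟ a ⌋ ∧ pendantAt adj a x)))
  ∨ ((⌊ x ≟ b ⌋ ∧ pendantAt adj a y) ∨ (⌊ y ≟ b ⌋ ∧ pendantAt adj a x))

module Submission where

-- Write a = v₁, b = v_{D-1}, c = v_{D-2}, and let K be the number of pendant neighbours of a.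
-- Since P is diametric, every neighbour of a other than v₂ is such a pendant vertex, so the move
-- turns a into a leaf hanging from v₂ and raises deg b by K, leaving all other degrees alone.
-- No eccentricity grows: a geodesic between non-pendant vertices never passes through a pendant
-- vertex, and from a moved pendant every vertex is within 1 + ε(b) ≤ D.  Of the numerators M(u),
-- only M(v₂) drops, from (1 + K)·Q to Q, while M(c) rises from deg(b)·R to (deg(b) + K)·R, where
-- Q and R are the products of the degrees of the other neighbours.  As ε(v₂) = ε(c) = D - 2 and
-- the hypothesis says exactly Q ≤ R, these two terms together do not decrease.  Finally M(v₀)
-- grows strictly, from 1 + K to deg(b) + K.

module FiniteSums where

  open import Algebra.Bundles using (CommutativeMonoid)
  import Algebra.Properties.CommutativeMonoid.Sum as CommutativeMonoidSum
  import Algebra.Properties.CommutativeSemigroup as CommutativeSemigroupProperties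
  open import Data.Fin as Fin using (Fin; zero; suc)
  open import Data.List using (foldr; map; allFin; tabulate)
  open import Data.List.Properties using (map-tabulate)
  open import Data.Nat as ℕ using (ℕ; _⊔_; z≤n)
  import Data.Nat.Properties as ℕ
  open import Data.Rational as ℚ using (ℚ)
  import Data.Rational.Properties as ℚ
  open import Data.Vec.Functional as Vector using (Vector; updateAt; replicate)
  open import Data.Vec.Functional.Properties using (updateAt-updates; updateAt-minimal)
  open import Function using (_∘_; id; const)
  open import Relation.Binary.Core using (Rel)
  open import Relation.Binary.Definitions using (Monotonic₂)
  open import Relation.Binary.PropositionalEquality as ≡ using (_≡_; _≢_; refl; cong; subst₂)
  open import Relation.Nullary using (yes; no)

  foldr-tabulate : ∀ {A B : Set} (_∙_ : A → B → B) (e : B) {n} (f : Fin n → A) →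
                   foldr _∙_ e (tabulate f) ≡ Vector.foldr _∙_ e f
  foldr-tabulate _∙_ e {ℕ.zero}  f = refl
  foldr-tabulate _∙_ e {ℕ.suc n} f = cong (f zero ∙_) (foldr-tabulate _∙_ e (f ∘ suc))

  foldr-map-allFin : ∀ {A B : Set} (_∙_ : A → B → B) (e : B) {n} (f : Fin n → A) →
                     foldr _∙_ e (map f (allFin n)) ≡ Vector.foldr _∙_ e f
  foldr-map-allFin _∙_ e f = ≡.trans (cong (foldr _∙_ e) (map-tabulate id f)) (foldr-tabulate _∙_ e f)

  module _ {A : Set} {ℓ} {_≤_ : Rel A ℓ} {_∙_ : A → A → A} {e : A}
           (∙-mono-≤ : Monotonic₂ _≤_ _≤_ _≤_ _∙_) (e≤e : e ≤ e) where

    foldr-mono-≤ : ∀ {n} {f g : Vector A n} → (∀ i → f i ≤ g i) →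
                   Vector.foldr _∙_ e f ≤ Vector.foldr _∙_ e g
    foldr-mono-≤ {ℕ.zero}  f≤g = e≤e
    foldr-mono-≤ {ℕ.suc n} f≤g = ∙-mono-≤ (f≤g zero) (foldr-mono-≤ (f≤g ∘ suc))

    foldr-mono-< : ∀ {ℓ'} {_<_ : Rel A ℓ'} → Monotonic₂ _<_ _≤_ _<_ _∙_ → Monotonic₂ _≤_ _<_ _<_ _∙_ →
                   ∀ {n} {f g : Vector A n} (r : Fin n) → (∀ i → f i ≤ g i) → f r < g r →
                   Vector.foldr _∙_ e f < Vector.foldr _∙_ e g
    foldr-mono-< ∙-mono-<-≤ ∙-mono-≤-< zero    f≤g fr<gr = ∙-mono-<-≤ fr<gr (foldr-mono-≤ (f≤g ∘ suc))
    foldr-mono-< {_<_ = _<_} ∙-mono-<-≤ ∙-mono-≤-< (suc r) f≤g fr<gr =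
      ∙-mono-≤-< (f≤g zero) (foldr-mono-< {_<_ = _<_} ∙-mono-<-≤ ∙-mono-≤-< r (f≤g ∘ suc) fr<gr)

  maximum : ∀ {n} → Vector ℕ n → ℕ
  maximum = Vector.foldr _⊔_ 0

  ≤-maximum : ∀ {n} (f : Vector ℕ n) i → f i ℕ.≤ maximum f
  ≤-maximum f zero    = ℕ.m≤m⊔n _ _
  ≤-maximum f (suc i) = ℕ.≤-trans (≤-maximum (f ∘ suc) i) (ℕ.m≤n⊔m _ _)

  maximum-least : ∀ {n} (f : Vector ℕ n) {m} → (∀ i → f i ℕ.≤ m) → maximum f ℕ.≤ m
  maximum-least {ℕ.zero}  f f≤m = z≤n
  maximum-least {ℕ.suc n} f f≤m = ℕ.⊔-lub (f≤m zero) (maximum-least (f ∘ suc) (f≤m ∘ suc))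

  module CommutativeMonoidSupport {c ℓ} (M : CommutativeMonoid c ℓ) where

    open CommutativeMonoid M
      renaming (_∙_ to _+_; ε to 0#; ∙-congˡ to +-congˡ; identityˡ to +-identityˡ; identityʳ to +-identityʳ)
    open CommutativeMonoidSum M public using (sum; sum-cong-≗; ∑-distrib-+)
    open CommutativeMonoidSum M using (sum-cong-≋; sum-replicate-zero)
    open CommutativeSemigroupProperties commutativeSemigroup using (x∙yz≈y∙xz)
    open import Relation.Binary.Reasoning.Setoid setoid

    erase : ∀ {n} → Vector Carrier n → Fin n → Vector Carrier n
    erase f p = updateAt f p (const 0#)

    erase-≢ : ∀ {n} (f : Vector Carrier n) {p i} → i ≢ p → erase f p i ≡ f i
    erase-≢ f {p} {i} i≢p = updateAt-minimal i p f i≢p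

    sum-erase : ∀ {n} (f : Vector Carrier n) p → sum f ≈ f p + sum (erase f p)
    sum-erase f zero    = +-congˡ (sym (+-identityˡ _))
    sum-erase f (suc p) = begin
      f zero + sum (f ∘ suc)                          ≈⟨ +-congˡ (sum-erase (f ∘ suc) p) ⟩
      f zero + (f (suc p) + sum (erase (f ∘ suc) p))  ≈⟨ x∙yz≈y∙xz _ _ _ ⟩
      f (suc p) + (f zero + sum (erase (f ∘ suc) p))  ∎

    sum-erase₂ : ∀ {n} (f : Vector Carrier n) {p q} → p ≢ q →
                 sum f ≈ (f p + f q) + sum (erase (erase f p) q)
    sum-erase₂ f {p} {q} p≢q = begin
      sum f                                            ≈⟨ sum-erase f p ⟩
      f p + sum (erase f p)                            ≈⟨ +-congˡ (sum-erase (erase f p) q) ⟩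
      f p + (erase f p q + sum (erase (erase f p) q))  ≡⟨ cong (λ x → f p + (x + sum (erase (erase f p) q)))
                                                               (erase-≢ f (p≢q ∘ ≡.sym)) ⟩
      f p + (f q + sum (erase (erase f p) q))          ≈⟨ sym (assoc _ _ _) ⟩
      (f p + f q) + sum (erase (erase f p) q)          ∎

    sum-support₁ : ∀ {n} (f : Vector Carrier n) p → (∀ i → i ≢ p → f i ≈ 0#) → sum f ≈ f p
    sum-support₁ {n} f p vanish = begin
      sum f                       ≈⟨ sum-erase f p ⟩
      f p + sum (erase f p)       ≈⟨ +-congˡ (sum-cong-≋ erased) ⟩
      f p + sum (replicate n 0#)  ≈⟨ +-congˡ (sum-replicate-zero n) ⟩
      f p + 0#                    ≈⟨ +-identityʳ _ ⟩
      f p                         ∎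
      where
      erased : ∀ i → erase f p i ≈ replicate n 0# i
      erased i with i Fin.≟ p
      ... | yes refl = reflexive (updateAt-updates p f)
      ... | no i≢p   = trans (reflexive (erase-≢ f i≢p)) (vanish i i≢p)

  module ℕ+ = CommutativeMonoidSupport ℕ.+-0-commutativeMonoid
  module ℕ* = CommutativeMonoidSupport ℕ.*-1-commutativeMonoid
  module ℚ+ = CommutativeMonoidSupport ℚ.+-0-commutativeMonoid

  ℚ+-sum-mono-≤ : ∀ {n} {f g : Vector ℚ n} → (∀ i → f i ℚ.≤ g i) → ℚ+.sum f ℚ.≤ ℚ+.sum g
  ℚ+-sum-mono-≤ = foldr-mono-≤ {_≤_ = ℚ._≤_} {_∙_ = ℚ._+_} {e = ℚ.0ℚ} ℚ.+-mono-≤ ℚ.≤-refl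

  ℚ+-sum-mono-< : ∀ {n} (f g : Vector ℚ n) {p q r} → p ≢ q → r ≢ p → r ≢ q →
                  (∀ i → i ≢ p → i ≢ q → f i ℚ.≤ g i) → f p ℚ.+ f q ℚ.≤ g p ℚ.+ g q → f r ℚ.< g r →
                  ℚ+.sum f ℚ.< ℚ+.sum g
  ℚ+-sum-mono-< f g {p} {q} {r} p≢q r≢p r≢q f≤g fpq≤gpq fr<gr =
    subst₂ ℚ._<_ (≡.sym (ℚ+.sum-erase₂ f p≢q)) (≡.sym (ℚ+.sum-erase₂ g p≢q))
      (ℚ.+-mono-≤-< fpq≤gpq rest<)
    where
    erased : ∀ h → ℚ+.erase (ℚ+.erase h p) q r ≡ h r
    erased h = ≡.trans (ℚ+.erase-≢ (ℚ+.erase h p) r≢q) (ℚ+.erase-≢ h r≢p)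
    rest≤ : ∀ i → ℚ+.erase (ℚ+.erase f p) q i ℚ.≤ ℚ+.erase (ℚ+.erase g p) q i
    rest≤ i with i Fin.≟ q | i Fin.≟ p
    ... | yes refl | _ = subst₂ ℚ._≤_ (≡.sym (updateAt-updates q _)) (≡.sym (updateAt-updates q _)) ℚ.≤-refl
    ... | no i≢q | yes refl = subst₂ ℚ._≤_ (≡.sym (≡.trans (ℚ+.erase-≢ _ i≢q) (updateAt-updates p f)))
                                          (≡.sym (≡.trans (ℚ+.erase-≢ _ i≢q) (updateAt-updates p g))) ℚ.≤-refl
    ... | no i≢q | no i≢p = subst₂ ℚ._≤_ (≡.sym (≡.trans (ℚ+.erase-≢ _ i≢q) (ℚ+.erase-≢ f i≢p)))
                                        (≡.sym (≡.trans (ℚ+.erase-≢ _ i≢q) (ℚ+.erase-≢ g i≢p))) (f≤g i i≢p i≢q)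
    rest< : ℚ+.sum (ℚ+.erase (ℚ+.erase f p) q) ℚ.< ℚ+.sum (ℚ+.erase (ℚ+.erase g p) q)
    rest< = foldr-mono-< {_≤_ = ℚ._≤_} {_∙_ = ℚ._+_} {e = ℚ.0ℚ} ℚ.+-mono-≤ ℚ.≤-refl {_<_ = ℚ._<_}
              ℚ.+-mono-<-≤ ℚ.+-mono-≤-< r rest≤
              (subst₂ ℚ._<_ (≡.sym (erased f)) (≡.sym (erased g)) fr<gr)

  ℕ*-sum-mono-≤ : ∀ {n} {f g : Vector ℕ n} → (∀ i → f i ℕ.≤ g i) → ℕ*.sum f ℕ.≤ ℕ*.sum g
  ℕ*-sum-mono-≤ = foldr-mono-≤ {_≤_ = ℕ._≤_} {_∙_ = ℕ._*_} {e = 1} ℕ.*-mono-≤ ℕ.≤-refl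

module Fractions where

  open import Defs
  open import Data.Integer as ℤ using (ℤ; +_)
  import Data.Integer.Properties as ℤ
  import Data.Integer.Tactic.RingSolver as ℤ
  open import Data.Nat.Tactic.RingSolver using (solve-∀)
  open import Data.Nat as ℕ using (ℕ; zero; suc; _+_; _*_)
  import Data.Nat.Properties as ℕ
  open import Data.Rational as ℚ using (ℚ)
  import Data.Rational.Properties as ℚ
  open import Data.Rational.Unnormalised as ℚᵘ using (ℚᵘ; mkℚᵘ; *≡*; *≤*; *<*)
  import Data.Rational.Unnormalised.Properties as ℚᵘ
  open import Relation.Binary.PropositionalEquality

  -- mkℚᵘ m d stands for m / (1 + d).
  toℚᵘ-frac : ∀ m d → ℚ.toℚᵘ (frac m (suc d)) ℚᵘ.≃ mkℚᵘ (+ m) d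
  toℚᵘ-frac m d = ℚ.toℚᵘ-fromℚᵘ (mkℚᵘ (+ m) d)

  frac-≤ : ∀ m m' d d' → m * suc d' ℕ.≤ m' * suc d → frac m (suc d) ℚ.≤ frac m' (suc d')
  frac-≤ m m' d d' cross =
    ℚ.toℚᵘ-cancel-≤ (ℚᵘ.≤-respˡ-≃ (ℚᵘ.≃-sym (toℚᵘ-frac m d)) (ℚᵘ.≤-respʳ-≃ (ℚᵘ.≃-sym (toℚᵘ-frac m' d'))
      (*≤* (subst₂ ℤ._≤_ (ℤ.pos-* m (suc d')) (ℤ.pos-* m' (suc d)) (ℤ.+≤+ cross)))))

  frac-< : ∀ m m' d d' → m * suc d' ℕ.< m' * suc d → frac m (suc d) ℚ.< frac m' (suc d')
  frac-< m m' d d' cross =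
    ℚ.toℚᵘ-cancel-< (ℚᵘ.<-respˡ-≃ (ℚᵘ.≃-sym (toℚᵘ-frac m d)) (ℚᵘ.<-respʳ-≃ (ℚᵘ.≃-sym (toℚᵘ-frac m' d'))
      (*<* (subst₂ ℤ._<_ (ℤ.pos-* m (suc d')) (ℤ.pos-* m' (suc d)) (ℤ.+<+ cross)))))

  frac-≤⁻¹ : ∀ m m' d d' → frac m (suc d) ℚ.≤ frac m' (suc d') → m * suc d' ℕ.≤ m' * suc d
  frac-≤⁻¹ m m' d d' le
    with ℚᵘ.≤-respˡ-≃ (toℚᵘ-frac m d) (ℚᵘ.≤-respʳ-≃ (toℚᵘ-frac m' d') (ℚ.toℚᵘ-mono-≤ le))
  ... | *≤* cross = ℤ.drop‿+≤+ (subst₂ ℤ._≤_ (sym (ℤ.pos-* m (suc d'))) (sym (ℤ.pos-* m' (suc d))) cross)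

  frac-+ : ∀ x y d → frac (x + y) (suc d) ≡ frac x (suc d) ℚ.+ frac y (suc d)
  frac-+ x y d = ℚ.toℚᵘ-injective (ℚᵘ.≃-trans (toℚᵘ-frac (x + y) d) (ℚᵘ.≃-sym
    (ℚᵘ.≃-trans (ℚ.toℚᵘ-homo-+ (frac x (suc d)) (frac y (suc d)))
      (ℚᵘ.≃-trans (ℚᵘ.+-cong (toℚᵘ-frac x d) (toℚᵘ-frac y d)) same-denominator))))
    where
    ring : ∀ (x y d : ℤ) → (x ℤ.* d ℤ.+ y ℤ.* d) ℤ.* d ≡ (x ℤ.+ y) ℤ.* (d ℤ.* d)
    ring = ℤ.solve-∀
    same-denominator : mkℚᵘ (+ x) d ℚᵘ.+ mkℚᵘ (+ y) d ℚᵘ.≃ mkℚᵘ (+ (x + y)) d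
    same-denominator = *≡* (trans (ring (+ x) (+ y) (+ suc d))
      (cong₂ ℤ._*_ (sym (ℤ.pos-+ x y)) (ℤ.pos-* (suc d) (suc d))))

  frac-monoˡ-≤ : ∀ {m m'} d → m ℕ.≤ m' → frac m d ℚ.≤ frac m' d
  frac-monoˡ-≤ zero    _    = ℚ.≤-refl
  frac-monoˡ-≤ {m} {m'} (suc d) m≤m' = frac-≤ m m' d d (ℕ.*-monoˡ-≤ (suc d) m≤m')

  frac-monoˡ-< : ∀ {m m' d} → 0 ℕ.< d → m ℕ.< m' → frac m d ℚ.< frac m' d
  frac-monoˡ-< {m} {m'} {suc d} _ m<m' = frac-< m m' d d (ℕ.*-monoˡ-< (suc d) m<m')

  frac-antitoneʳ : ∀ m {d d'} → 0 ℕ.< d' → d' ℕ.≤ d → frac m d ℚ.≤ frac m d'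
  frac-antitoneʳ m {suc d} {suc d'} _ d'≤d = frac-≤ m m d d' (ℕ.*-monoʳ-≤ m d'≤d)

  frac-cancel-≤ : ∀ k l x y → frac (suc k * x) (suc k) ℚ.≤ frac (suc l * y) (suc l) → x ℕ.≤ y
  frac-cancel-≤ k l x y le =
    ℕ.*-cancelʳ-≤ x y (suc k * suc l)
      (subst₂ ℕ._≤_ (rearrange k l x) (rearrange′ k l y) (frac-≤⁻¹ (suc k * x) (suc l * y) k l le))
    where
    rearrange : ∀ k l x → suc k * x * suc l ≡ x * (suc k * suc l)
    rearrange = solve-∀
    rearrange′ : ∀ k l y → suc l * y * suc k ≡ y * (suc k * suc l)
    rearrange′ = solve-∀

  shift-weight-≤ : ∀ K B {Q R} → Q ℕ.≤ R → suc K * Q + B * R ℕ.≤ 1 * Q + (B + K) * R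
  shift-weight-≤ K B {Q} {R} Q≤R =
    subst₂ ℕ._≤_ (sym (regroupˡ K B Q R)) (sym (regroupʳ K B Q R)) (ℕ.+-monoʳ-≤ (Q + B * R) (ℕ.*-monoʳ-≤ K Q≤R))
    where
    regroupˡ : ∀ K B Q R → suc K * Q + B * R ≡ (Q + B * R) + K * Q
    regroupˡ = solve-∀
    regroupʳ : ∀ K B Q R → 1 * Q + (B + K) * R ≡ (Q + B * R) + K * R
    regroupʳ = solve-∀

module Walks where

  open import Defs
  open import Data.Bool using (Bool; true; false; _∧_)
  open import Data.Bool.ListAction using (any)
  open import Data.Bool.Properties using (T-≡; ∨-zeroʳ)
  open import Data.Empty using (⊥-elim)
  open import Data.Fin as Fin using (Fin)
  open import Data.Fin.Properties using (toℕ<n)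
  open import Data.List using (allFin)
  open import Data.List.Membership.Propositional using (lose)
  open import Data.List.Membership.Propositional.Properties using (∈-allFin)
  open import Data.List.Relation.Unary.Any using (satisfied)
  open import Data.List.Relation.Unary.Any.Properties using (any⁺; any⁻)
  open import Data.Nat as ℕ using (ℕ; zero; suc; _+_; _∸_; _≤_; _<_; z≤n; s≤s)
  open import Data.Nat.Properties
  open import Data.Product using (Σ; ∃; _×_; _,_; map₂)
  open import Data.Sum using (_⊎_; inj₁; inj₂)
  open import Function using (Equivalence)
  open import Relation.Binary.PropositionalEquality
  open import Relation.Nullary using (yes; no)
  open import Relation.Nullary.Decidable using (⌊_⌋; isYes≗does; dec-true; dec-false; toWitness)
  open Equivalence using (to; from)

  true≢false : true ≢ false
  true≢false ()

  ≟-refl : ∀ {n} (x : Fin n) → ⌊ x Fin.≟ x ⌋ ≡ true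
  ≟-refl x = trans (isYes≗does (x Fin.≟ x)) (dec-true (x Fin.≟ x) refl)

  ≟-≢ : ∀ {n} {x y : Fin n} → x ≢ y → ⌊ x Fin.≟ y ⌋ ≡ false
  ≟-≢ {x = x} {y} x≢y = trans (isYes≗does (x Fin.≟ y)) (dec-false (x Fin.≟ y) x≢y)

  ≟⇒≡ : ∀ {n} {x y : Fin n} → ⌊ x Fin.≟ y ⌋ ≡ true → x ≡ y
  ≟⇒≡ x≟y = toWitness (from T-≡ x≟y)

  any-allFin⁺ : ∀ {n} (p : Fin n → Bool) i → p i ≡ true → any p (allFin n) ≡ true
  any-allFin⁺ p i pi = to T-≡ (any⁺ p (lose (∈-allFin i) (from T-≡ pi)))

  any-allFin⁻ : ∀ {n} (p : Fin n → Bool) → any p (allFin n) ≡ true → ∃ λ i → p i ≡ true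
  any-allFin⁻ p h = map₂ (to T-≡) (satisfied (any⁻ p (allFin _) (from T-≡ h)))

  module _ {X : Set} where

    append : ℕ → (ℕ → X) → (ℕ → X) → ℕ → X
    append L p q j with j ℕ.≤? L
    ... | yes _ = p j
    ... | no _  = q (j ∸ L)

    append-≤ : ∀ L p q {j} → j ≤ L → append L p q j ≡ p j
    append-≤ L p q {j} j≤L with j ℕ.≤? L
    ... | yes _  = refl
    ... | no j≰L = ⊥-elim (j≰L j≤L)

    append-+ : ∀ L p q t → p L ≡ q 0 → append L p q (L + t) ≡ q t
    append-+ L p q zero    pL≡q0 rewrite +-identityʳ L = trans (append-≤ L p q ≤-refl) pL≡q0
    append-+ L p q (suc t) _ with (L + suc t) ℕ.≤? L
    ... | yes L+1+t≤L = ⊥-elim (m+1+n≰m L L+1+t≤L)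
    ... | no _        = cong q (m+n∸m≡n L (suc t))

    edge : X → X → ℕ → X
    edge x y zero    = x
    edge x y (suc _) = y

    reverse : ℕ → (ℕ → X) → ℕ → X
    reverse L w j = w (L ∸ j)

    drop : ℕ → (ℕ → X) → ℕ → X
    drop i w t = w (i + t)

  below-or-beyond : ∀ L j → j < L ⊎ ∃ λ t → j ≡ L + t
  below-or-beyond L j with j ℕ.<? L
  ... | yes j<L = inj₁ j<L
  ... | no j≮L  = inj₂ (j ∸ L , sym (m+[n∸m]≡n (≮⇒≥ j≮L)))

  ∸-suc : ∀ L j → j < L → L ∸ j ≡ suc (L ∸ suc j)
  ∸-suc (suc L) zero    _         = refl
  ∸-suc (suc L) (suc j) (s≤s j<L) = ∸-suc L j j<L

  module _ {n : ℕ} (G : Graph n) where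

    IsWalk : ℕ → (ℕ → Fin n) → Set
    IsWalk L w = ∀ j → j < L → G (w j) (w (suc j)) ≡ true

    NonBacktracking : ℕ → (ℕ → Fin n) → Set
    NonBacktracking L w = ∀ j → 2 + j ≤ L → w j ≢ w (2 + j)

    IsWalk-≤ : ∀ {L L'} {w} → L' ≤ L → IsWalk L w → IsWalk L' w
    IsWalk-≤ L'≤L walk j j<L' = walk j (<-≤-trans j<L' L'≤L)

    NonBacktracking-≤ : ∀ {L L'} {w} → L' ≤ L → NonBacktracking L w → NonBacktracking L' w
    NonBacktracking-≤ L'≤L nb j j<L' = nb j (≤-trans j<L' L'≤L)

    edge-walk : ∀ {x y} → G x y ≡ true → IsWalk 1 (edge x y)
    edge-walk xy zero    _         = xy
    edge-walk xy (suc _) (s≤s ())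

    append-walk : ∀ L₁ L₂ {p q} → IsWalk L₁ p → IsWalk L₂ q → p L₁ ≡ q 0 →
                  IsWalk (L₁ + L₂) (append L₁ p q)
    append-walk L₁ L₂ {p} {q} wp wq meet j j<L with below-or-beyond L₁ j
    ... | inj₁ j<L₁ rewrite append-≤ L₁ p q (<⇒≤ j<L₁) | append-≤ L₁ p q j<L₁ = wp j j<L₁
    ... | inj₂ (t , refl) =
      subst₂ (λ a b → G a b ≡ true)
        (sym (append-+ L₁ p q t meet))
        (sym (trans (cong (append L₁ p q) (sym (+-suc L₁ t))) (append-+ L₁ p q (suc t) meet)))
        (wq t (+-cancelˡ-< L₁ t L₂ j<L))

    drop-walk : ∀ i L {w} → IsWalk (i + L) w → IsWalk L (drop i w)
    drop-walk i L {w} walk j j<L rewrite +-suc i j = walk (i + j) (+-monoʳ-< i j<L)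

    drop-nonBacktracking : ∀ i L {w} → NonBacktracking (i + L) w → NonBacktracking L (drop i w)
    drop-nonBacktracking i L {w} nb j j<L rewrite +-suc i (suc j) | +-suc i j =
      nb (i + j) (subst (_≤ i + L) (trans (+-suc i (suc j)) (cong suc (+-suc i j))) (+-monoʳ-≤ i j<L))

    walk⇒reach : ∀ L w → IsWalk L w → reach G L (w 0) (w L) ≡ true
    walk⇒reach zero    w walk = ≟-refl (w 0)
    walk⇒reach (suc L) w walk
      rewrite any-allFin⁺ (λ x → reach G L (w 0) x ∧ G x (w (suc L))) (w L)
                (cong₂ _∧_ (walk⇒reach L w (IsWalk-≤ (n≤1+n L) walk)) (walk L (n<1+n L))) =
        ∨-zeroʳ _

    WalkBetween : Fin n → Fin n → ℕ → Set
    WalkBetween u v L = Σ (ℕ → Fin n) λ w → w 0 ≡ u × w L ≡ v × IsWalk L w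

    walkBetween-edge : ∀ {u v} → G u v ≡ true → WalkBetween u v 1
    walkBetween-edge uv = edge _ _ , refl , refl , edge-walk uv

    walkBetween-++ : ∀ {u x v} L₁ L₂ → WalkBetween u x L₁ → WalkBetween x v L₂ → WalkBetween u v (L₁ + L₂)
    walkBetween-++ L₁ L₂ (p , p0 , pL , walk-p) (q , q0 , qL , walk-q) =
      append L₁ p q , trans (append-≤ L₁ p q z≤n) p0 , trans (append-+ L₁ p q L₂ meet) qL ,
      append-walk L₁ L₂ walk-p walk-q meet
      where
      meet : p L₁ ≡ q 0
      meet = trans pL (sym q0)

    reach⇒walk : ∀ k u v → reach G k u v ≡ true → ∃ λ L → L ≤ k × WalkBetween u v L
    reach⇒walk zero u v r with u Fin.≟ v
    reach⇒walk zero u .u r | yes refl = 0 , z≤n , (λ _ → u) , refl , refl , λ _ ()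
    reach⇒walk (suc k) u v r with reach G k u v in r-k
    ... | true = let (L , L≤k , walk) = reach⇒walk k u v r-k in L , m≤n⇒m≤1+n L≤k , walk
    ... | false with any-allFin⁻ (λ x → reach G k u x ∧ G x v) r
    ... | (x , last) with reach G k u x in r-x | G x v in xv
    ... | true | true =
      let (L , L≤k , walk) = reach⇒walk k u x r-x
      in L + 1 , subst (_≤ suc k) (+-comm 1 L) (s≤s L≤k) , walkBetween-++ L 1 walk (walkBetween-edge xv)

    distFrom-≥ : ∀ u v k f → k ≤ distFrom G u v k f
    distFrom-≥ u v k zero = ≤-refl
    distFrom-≥ u v k (suc f) with reach G k u v
    ... | true  = ≤-refl
    ... | false = ≤-trans (n≤1+n k) (distFrom-≥ u v (suc k) f)

    distFrom-≤-reach : ∀ u v k f {m} → reach G m u v ≡ true → k ≤ m → distFrom G u v k f ≤ m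
    distFrom-≤-reach u v k zero    r k≤m = k≤m
    distFrom-≤-reach u v k (suc f) r k≤m with reach G k u v in r-k
    ... | true = k≤m
    ... | false with m≤n⇒m<n∨m≡n k≤m
    ... | inj₁ k<m  = distFrom-≤-reach u v (suc k) f r k<m
    ... | inj₂ refl = ⊥-elim (true≢false (trans (sym r) r-k))

    distFrom-≥-unreachable : ∀ u v k f m → k ≤ m → (∀ j → k ≤ j → j < m → reach G j u v ≡ false) →
                             m ≤ k + f → m ≤ distFrom G u v k f
    distFrom-≥-unreachable u v k zero    m k≤m far m≤k+f = subst (m ≤_) (+-identityʳ k) m≤k+f
    distFrom-≥-unreachable u v k (suc f) m k≤m far m≤k+f with m≤n⇒m<n∨m≡n k≤m
    ... | inj₂ refl = distFrom-≥ u v k (suc f)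
    ... | inj₁ k<m rewrite far k ≤-refl k<m =
      distFrom-≥-unreachable u v (suc k) f m k<m (λ j k<j → far j (<⇒≤ k<j)) (subst (m ≤_) (+-suc k f) m≤k+f)

    dist-≤-reach : ∀ u v {m} → reach G m u v ≡ true → dist G u v ≤ m
    dist-≤-reach u v r = distFrom-≤-reach u v 0 n r z≤n

    dist-≤-length : ∀ L w → IsWalk L w → dist G (w 0) (w L) ≤ L
    dist-≤-length L w walk = dist-≤-reach _ _ (walk⇒reach L w walk)

    dist-≤-walk : ∀ {u v} L → WalkBetween u v L → dist G u v ≤ L
    dist-≤-walk L (w , refl , refl , walk) = dist-≤-length L w walk

    dist-≥-unreachable : ∀ u v m → m ≤ n → (∀ j → j < m → reach G j u v ≡ false) → m ≤ dist G u v
    dist-≥-unreachable u v m m≤n far = distFrom-≥-unreachable u v 0 n m z≤n (λ j _ → far j) m≤n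

    dist-positive : ∀ {u v} → u ≢ v → 0 < dist G u v
    dist-positive {u} {v} u≢v =
      dist-≥-unreachable u v 1 (≤-trans (s≤s z≤n) (toℕ<n u)) λ { zero _ → ≟-≢ u≢v ; (suc _) (s≤s ()) }

module TreeWalks where

  open import Defs
  open Walks
  open import Data.Bool using (true; false)
  open import Data.Empty using (⊥; ⊥-elim)
  open import Data.Fin as Fin using (Fin)
  open import Data.Fin.Properties using (injective⇒≤; toℕ-injective; toℕ≤pred[n])
  open import Data.Nat as ℕ using (ℕ; zero; suc; _+_; _∸_; _≤_; _<_; z≤n; s≤s)
  open import Data.Nat.Properties
  open import Data.Product using (Σ; ∃; _×_; _,_)
  open import Data.Sum using (inj₁; inj₂)
  open import Relation.Binary.PropositionalEquality
  open import Relation.Nullary using (Dec; yes; no)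
  open import Relation.Nullary.Decidable using (_×-dec_)

  module _ {n : ℕ} (G : Graph n) where

    reverse-walk : Symmetric G → ∀ L {w} → IsWalk G L w → IsWalk G L (reverse L w)
    reverse-walk sym-G L {w} walk j j<L rewrite ∸-suc L j j<L =
      trans (sym-G _ _) (walk (L ∸ suc j) (subst (_≤ L) (∸-suc L j j<L) (m∸n≤m L j)))

    reverse-nonBacktracking : ∀ L {w} → NonBacktracking G L w → NonBacktracking G L (reverse L w)
    reverse-nonBacktracking L {w} nb j 2+j≤L eq =
      nb (L ∸ (2 + j)) (subst (_≤ L) L∸j≡ (m∸n≤m L j)) (sym (trans (cong w (sym L∸j≡)) eq))
      where
      L∸j≡ : L ∸ j ≡ 2 + (L ∸ (2 + j))
      L∸j≡ = trans (∸-suc L j (<-trans (n<1+n j) 2+j≤L)) (cong suc (∸-suc L (suc j) 2+j≤L))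

    append-nonBacktracking : ∀ L₁ L₂ {p q} → NonBacktracking G (suc L₁) p → NonBacktracking G L₂ q →
                             p (suc L₁) ≡ q 0 → (1 ≤ L₂ → p L₁ ≢ q 1) →
                             NonBacktracking G (suc L₁ + L₂) (append (suc L₁) p q)
    append-nonBacktracking L₁ L₂ {p} {q} nb-p nb-q meet turn j 2+j≤L eq
      with below-or-beyond (suc L₁) j
    ... | inj₂ (t , refl) =
      nb-q t (+-cancelˡ-≤ (suc L₁) _ _ (subst (_≤ suc L₁ + L₂) shift 2+j≤L))
        (trans (sym (append-+ (suc L₁) p q t meet))
          (trans eq (trans (cong (append (suc L₁) p q) shift) (append-+ (suc L₁) p q (2 + t) meet))))
      where
      shift : 2 + (suc L₁ + t) ≡ suc L₁ + (2 + t)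
      shift = sym (trans (+-suc (suc L₁) (suc t)) (cong suc (+-suc (suc L₁) t)))
    ... | inj₁ j<1+L₁ = inside (2 + j ℕ.≤? suc L₁)
      where
      inside : Dec (2 + j ≤ suc L₁) → ⊥
      inside (yes 2+j≤1+L₁) =
        nb-p j 2+j≤1+L₁
          (trans (sym (append-≤ (suc L₁) p q (<⇒≤ j<1+L₁))) (trans eq (append-≤ (suc L₁) p q 2+j≤1+L₁)))
      inside (no 2+j≰1+L₁) =
        turn (+-cancelˡ-≤ (suc L₁) 1 L₂ (subst (_≤ suc L₁ + L₂) at-junction 2+j≤L))
          (trans (cong p (sym j≡L₁))
            (trans (sym (append-≤ (suc L₁) p q (<⇒≤ j<1+L₁)))
              (trans eq (trans (cong (append (suc L₁) p q) at-junction) (append-+ (suc L₁) p q 1 meet)))))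
        where
        j≡L₁ : j ≡ L₁
        j≡L₁ = ≤-antisym (≤-pred j<1+L₁) (≤-pred (≤-pred (≰⇒> 2+j≰1+L₁)))
        at-junction : 2 + j ≡ suc L₁ + 1
        at-junction = trans (cong (2 +_) j≡L₁) (cong suc (+-comm 1 L₁))

    cut-backtrack : ∀ L {w} j → IsWalk G L w → 2 + j ≤ L → w j ≡ w (2 + j) →
                    ∃ λ L' → L' < L × WalkBetween G (w 0) (w L) L'
    cut-backtrack L {w} j walk 2+j≤L back =
      j + t , shorter , append j w (drop (2 + j) w) , append-≤ j w (drop (2 + j) w) z≤n ,
      trans (append-+ j w _ t back′) (cong w L≡) ,
      append-walk G j t (IsWalk-≤ G (≤-trans (n≤1+n j) (<⇒≤ 2+j≤L)) walk)
        (drop-walk G (2 + j) t (subst (λ L → IsWalk G L w) (sym L≡) walk)) back′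
      where
      t = L ∸ (2 + j)
      L≡ : 2 + j + t ≡ L
      L≡ = m+[n∸m]≡n 2+j≤L
      back′ : w j ≡ drop (2 + j) w 0
      back′ = trans back (cong w (sym (+-identityʳ _)))
      shorter : j + t < L
      shorter = subst (j + t <_) L≡ (s≤s (n≤1+n (j + t)))

    NBWalk : Fin n → Fin n → ℕ → Set
    NBWalk u v L = Σ (ℕ → Fin n) λ w → w 0 ≡ u × w L ≡ v × IsWalk G L w × NonBacktracking G L w

    nonBacktracking-shortening : ∀ L w → IsWalk G L w → ∃ λ L' → L' ≤ L × NBWalk (w 0) (w L) L'
    nonBacktracking-shortening L w = go L L w ≤-refl
      where
      go : ∀ fuel L w → L ≤ fuel → IsWalk G L w → ∃ λ L' → L' ≤ L × NBWalk (w 0) (w L) L'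
      go fuel L w L≤fuel walk
        with anyUpTo? (λ j → (2 + j ℕ.≤? L) ×-dec (w j Fin.≟ w (2 + j))) L
      ... | no none = L , ≤-refl , w , refl , refl , walk ,
                      λ j 2+j≤L back → none (j , <-trans (n<1+n j) 2+j≤L , 2+j≤L , back)
      ... | yes (j , _ , 2+j≤L , back) with cut-backtrack L j walk 2+j≤L back
      ... | (L'' , L''<L , w'' , w''0 , w''L , walk'') with fuel
      ...   | zero = ⊥-elim (n≮0 (<-≤-trans L''<L L≤fuel))
      ...   | suc fuel' with go fuel' L'' w'' (≤-pred (<-≤-trans L''<L L≤fuel)) walk''
      ...     | (L' , L'≤L'' , w' , w'0 , w'L , walk' , nb') =
        L' , ≤-trans L'≤L'' (<⇒≤ L''<L) , w' , trans w'0 w''0 , trans w'L w''L , walk' , nb'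

    Walk⇒walk : ∀ {u v} → Walk G u v → ∃ (WalkBetween G u v)
    Walk⇒walk {u} here = 0 , (λ _ → u) , refl , refl , λ _ ()
    Walk⇒walk {u} (step {w = x} ux rest) with Walk⇒walk rest
    ... | (L , w , w0 , wL , walk) = suc L , cons , refl , wL , walk′
      where
      cons : ℕ → Fin n
      cons zero    = u
      cons (suc t) = w t
      walk′ : IsWalk G (suc L) cons
      walk′ zero    _         = subst (λ x → G u x ≡ true) (sym w0) ux
      walk′ (suc j) (s≤s j<L) = walk j j<L

  module Tree {n : ℕ} {G : Graph n} (tree : IsTree G) where

    open IsTree tree

    module NonBacktrackingWalk (L : ℕ) (w : ℕ → Fin n) (walk : IsWalk G L w) (nb : NonBacktracking G L w) where

      InjectiveUpTo : ℕ → Set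
      InjectiveUpTo m = ∀ i j → i ≤ m → j ≤ m → w i ≡ w j → i ≡ j

      -- A first return w i ≡ w (1 + i + k) is a loop (k = 0), a backtrack (k = 1) or a cycle (k ≥ 2).
      no-first-return : ∀ i k → i + k < L → w i ≡ w (suc (i + k)) →
                        (∀ a b → a ≤ k → b ≤ k → w (i + a) ≡ w (i + b) → a ≡ b) → ⊥
      no-first-return i zero i<L loop _ rewrite +-identityʳ i
        with trans (sym (irreflexive (w i))) (subst (λ x → G (w i) x ≡ true) (sym loop) (walk i i<L))
      ... | ()
      no-first-return i (suc zero) i+1<L back _ rewrite +-comm i 1 = nb i i+1<L back
      no-first-return i k@(suc (suc _)) i+k<L ret distinct = acyclic record
        { len      = suc k
        ; len≥3    = s≤s (s≤s (s≤s z≤n))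
        ; c        = drop i w
        ; distinct = λ a b a<1+k b<1+k → distinct a b (≤-pred a<1+k) (≤-pred b<1+k)
        ; consec   = λ t 1+t<1+k → subst (λ x → G (w (i + t)) (w x) ≡ true) (sym (+-suc i t))
                                     (walk (i + t) (<-trans (+-monoʳ-< i (≤-pred 1+t<1+k)) i+k<L))
        ; close    = subst (λ x → G (w (i + k)) x ≡ true) (trans (sym ret) (cong w (sym (+-identityʳ i))))
                       (walk (i + k) i+k<L)
        }

      injective-step : ∀ m → m < L → InjectiveUpTo m → InjectiveUpTo (suc m)
      injective-step m m<L inj with anyUpTo? (λ i → w i Fin.≟ w (suc m)) (suc m)
      ... | yes (i , i<1+m , ret) =
        ⊥-elim (no-first-return i (m ∸ i) (subst (_< L) (sym i+k≡m) m<L)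
          (trans ret (cong (λ x → w (suc x)) (sym i+k≡m)))
          (λ a b a≤k b≤k eq → +-cancelˡ-≡ i a b (inj (i + a) (i + b) (within a≤k) (within b≤k) eq)))
        where
        i+k≡m : i + (m ∸ i) ≡ m
        i+k≡m = m+[n∸m]≡n (≤-pred i<1+m)
        within : ∀ {a} → a ≤ m ∸ i → i + a ≤ m
        within a≤k = subst (i + _ ≤_) i+k≡m (+-monoʳ-≤ i a≤k)
      ... | no fresh = λ i j i≤1+m j≤1+m eq → go i j (m≤n⇒m<n∨m≡n i≤1+m) (m≤n⇒m<n∨m≡n j≤1+m) eq
        where
        go : ∀ i j → _ → _ → w i ≡ w j → i ≡ j
        go i j (inj₁ i<1+m) (inj₁ j<1+m) eq = inj i j (≤-pred i<1+m) (≤-pred j<1+m) eq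
        go i _ (inj₁ i<1+m) (inj₂ refl) eq = ⊥-elim (fresh (i , i<1+m , eq))
        go _ j (inj₂ refl) (inj₁ j<1+m) eq = ⊥-elim (fresh (j , j<1+m , sym eq))
        go _ _ (inj₂ refl) (inj₂ refl) _   = refl

      injective : ∀ i j → i ≤ L → j ≤ L → w i ≡ w j → i ≡ j
      injective = upTo L ≤-refl
        where
        upTo : ∀ m → m ≤ L → InjectiveUpTo m
        upTo zero    _   _ _ z≤n z≤n _ = refl
        upTo (suc m) m<L = injective-step m m<L (upTo m (<⇒≤ m<L))

      length<n : L < n
      length<n = injective⇒≤ {f = λ (i : Fin (suc L)) → w (Fin.toℕ i)}
        (λ {i} {j} eq → toℕ-injective (injective (Fin.toℕ i) (Fin.toℕ j) (toℕ≤pred[n] i) (toℕ≤pred[n] j) eq))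

    nonBacktracking-open : ∀ L w → IsWalk G (suc L) w → NonBacktracking G (suc L) w → w 0 ≢ w (suc L)
    nonBacktracking-open L w walk nb closed
      with NonBacktrackingWalk.injective (suc L) w walk nb 0 (suc L) z≤n ≤-refl closed
    ... | ()

    -- If the last steps differ, p followed by q reversed would be a closed non-backtracking walk.
    nonBacktracking-length-unique : ∀ Lp Lq {p q} → IsWalk G Lp p → NonBacktracking G Lp p →
                                    IsWalk G Lq q → NonBacktracking G Lq q → p 0 ≡ q 0 → p Lp ≡ q Lq → Lp ≡ Lq
    nonBacktracking-length-unique zero    zero    _  _  _  _  _  _  = refl
    nonBacktracking-length-unique zero    (suc b) _  _  wq nq s₀ t₀ =
      ⊥-elim (nonBacktracking-open b _ wq nq (trans (sym s₀) t₀))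
    nonBacktracking-length-unique (suc a) zero    wp np _  _  s₀ t₀ =
      ⊥-elim (nonBacktracking-open a _ wp np (trans s₀ (sym t₀)))
    nonBacktracking-length-unique (suc a) (suc b) {p} {q} wp np wq nq s₀ t₀ with p a Fin.≟ q b
    ... | yes pa≡qb = cong suc (nonBacktracking-length-unique a b
            (IsWalk-≤ G (n≤1+n a) wp) (NonBacktracking-≤ G (n≤1+n a) np)
            (IsWalk-≤ G (n≤1+n b) wq) (NonBacktracking-≤ G (n≤1+n b) nq) s₀ pa≡qb)
    ... | no pa≢qb = ⊥-elim (nonBacktracking-open (a + suc b) r
            (append-walk G (suc a) (suc b) wp (reverse-walk G symmetric (suc b) wq) t₀)
            (append-nonBacktracking G a (suc b) np (reverse-nonBacktracking G (suc b) nq) t₀ (λ _ → pa≢qb))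
            (trans (append-≤ (suc a) p (reverse (suc b) q) z≤n)
              (trans s₀ (sym (trans (append-+ (suc a) p _ (suc b) t₀) (cong q (n∸n≡0 b)))))))
      where
      r = append (suc a) p (reverse (suc b) q)

    nonBacktracking-dist : ∀ {u v} L → NBWalk G u v L → dist G u v ≡ L
    nonBacktracking-dist L (w , refl , refl , walk , nb) =
      ≤-antisym (dist-≤-length G L w walk)
                (dist-≥-unreachable G _ _ L (<⇒≤ (NonBacktrackingWalk.length<n L w walk nb)) unreachable)
      where
      unreachable : ∀ j → j < L → reach G j (w 0) (w L) ≡ false
      unreachable j j<L with reach G j (w 0) (w L) in r
      ... | false = refl
      ... | true with reach⇒walk G j _ _ r
      ... | (L₁ , L₁≤j , w₁ , s₁ , t₁ , walk₁) with nonBacktracking-shortening G L₁ w₁ walk₁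
      ... | (L₂ , L₂≤L₁ , w₂ , s₂ , t₂ , walk₂ , nb₂)
        with nonBacktracking-length-unique L₂ L walk₂ nb₂ walk nb (trans s₂ s₁) (trans t₂ t₁)
      ... | refl = ⊥-elim (<-irrefl refl (≤-<-trans (≤-trans L₂≤L₁ L₁≤j) j<L))

    geodesic : ∀ u v → NBWalk G u v (dist G u v)
    geodesic u v with Walk⇒walk G (connected u v)
    ... | (L , w , w0 , wL , walk) with nonBacktracking-shortening G L w walk
    ... | (L' , _ , w' , w'0 , w'L , walk' , nb') =
      subst (NBWalk G u v) (sym (nonBacktracking-dist L' nb-walk)) nb-walk
      where
      nb-walk : NBWalk G u v L'
      nb-walk = w' , trans w'0 w0 , trans w'L wL , walk' , nb'

    dist-sym : ∀ u v → dist G u v ≡ dist G v u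
    dist-sym u v with geodesic u v
    ... | (w , w0 , wL , walk , nb) = sym (nonBacktracking-dist (dist G u v)
            (reverse _ w , wL , trans (cong w (n∸n≡0 (dist G u v))) w0 ,
             reverse-walk G symmetric _ walk , reverse-nonBacktracking G _ nb))

module GraphInvariants where

  open import Defs
  open FiniteSums
  open import Data.Bool using (Bool; true; false; if_then_else_; _∧_; _∨_; not)
  open import Data.Empty using (⊥; ⊥-elim)
  open import Data.Fin as Fin using (Fin)
  open import Data.Nat as ℕ using (ℕ; _+_; _*_; _⊔_; _≤_)
  import Data.Nat.Properties as ℕ
  open import Data.Product using (_×_; _,_; proj₂)
  open import Data.Vec.Functional.Properties using (updateAt-updates)
  open import Relation.Binary.PropositionalEquality
  open import Relation.Nullary using (yes; no)

  indicator : Bool → ℕ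
  indicator b = if b then 1 else 0

  module _ {n : ℕ} (G : Graph n) where

    neighbourFactor : Fin n → Fin n → ℕ
    neighbourFactor u y = if G u y then deg G y else 1

    deg-sum : ∀ u → deg G u ≡ ℕ+.sum (λ y → indicator (G u y))
    deg-sum u = foldr-map-allFin _+_ 0 (λ y → indicator (G u y))

    M-product : ∀ u → M G u ≡ ℕ*.sum (neighbourFactor u)
    M-product u = foldr-map-allFin ℕ._*_ 1 (neighbourFactor u)

    ecc-maximum : ∀ u → ecc G u ≡ maximum (dist G u)
    ecc-maximum u = foldr-map-allFin _⊔_ 0 (dist G u)

    dist-≤-ecc : ∀ u x → dist G u x ≤ ecc G u
    dist-≤-ecc u x = subst (dist G u x ≤_) (sym (ecc-maximum u)) (≤-maximum (dist G u) x)

    ecc-least : ∀ u {m} → (∀ x → dist G u x ≤ m) → ecc G u ≤ m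
    ecc-least u {m} bound = subst (_≤ m) (sym (ecc-maximum u)) (maximum-least (dist G u) bound)

    ecc-≤-diameter : ∀ u → ecc G u ≤ diameter G
    ecc-≤-diameter u = subst (ecc G u ≤_) (sym (foldr-map-allFin _⊔_ 0 (ecc G))) (≤-maximum (ecc G) u)

    neighbourFactor-adjacent : ∀ {u y} → G u y ≡ true → neighbourFactor u y ≡ deg G y
    neighbourFactor-adjacent uy rewrite uy = refl

    two-neighbours⇒2≤deg : ∀ {x y z} → G x y ≡ true → G x z ≡ true → y ≢ z → 2 ≤ deg G x
    two-neighbours⇒2≤deg {x} {y} {z} xy xz y≢z =
      subst (2 ≤_) (sym (deg-sum x))
        (ℕ.≤-trans (ℕ.≤-reflexive (cong₂ _+_ (sym (cong indicator xy)) (sym (cong indicator xz))))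
          (subst (_ ≤_) (sym (ℕ+.sum-erase₂ (λ w → indicator (G x w)) y≢z)) (ℕ.m≤m+n _ _)))

    leaf-neighbour-unique : ∀ {x a y} → deg G x ≡ 1 → G x a ≡ true → G x y ≡ true → y ≡ a
    leaf-neighbour-unique {x} {a} {y} leaf xa xy with y Fin.≟ a
    ... | yes y≡a = y≡a
    ... | no y≢a  = ⊥-elim (ℕ.<-irrefl (sym leaf) (two-neighbours⇒2≤deg xy xa y≢a))

    module _ {x a : Fin n} (xa : G x a ≡ true) (only-a : ∀ y → G x y ≡ true → y ≡ a) where

      deg-single-neighbour : deg G x ≡ 1
      deg-single-neighbour = trans (deg-sum x) (trans (ℕ+.sum-support₁ _ a vanish) (cong indicator xa))
        where
        vanish : ∀ y → y ≢ a → indicator (G x y) ≡ 0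
        vanish y y≢a with G x y in xy
        ... | true  = ⊥-elim (y≢a (only-a y xy))
        ... | false = refl

      M-single-neighbour : M G x ≡ deg G a
      M-single-neighbour = trans (M-product x) (trans (ℕ*.sum-support₁ _ a vanish) (neighbourFactor-adjacent xa))
        where
        vanish : ∀ y → y ≢ a → neighbourFactor x y ≡ 1
        vanish y y≢a with G x y in xy
        ... | true  = ⊥-elim (y≢a (only-a y xy))
        ... | false = refl

    pendantAt-adjacent-leaf : ∀ {a x} → pendantAt G a x ≡ true → G a x ≡ true × deg G x ≡ 1
    pendantAt-adjacent-leaf {a} {x} pendant with G a x | deg G x ℕ.≟ 1
    ... | true | yes leaf = refl , leaf

    pendantAt-neighbour : Symmetric G → ∀ {a x y} → pendantAt G a x ≡ true → G x y ≡ true → y ≡ a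
    pendantAt-neighbour sym-G {a} {x} pendant xy with pendantAt-adjacent-leaf pendant
    ... | ax , leaf = leaf-neighbour-unique leaf (trans (sym-G x a) ax) xy

    2≤deg⇒¬pendantAt : ∀ {a x} → 2 ≤ deg G x → pendantAt G a x ≡ false
    2≤deg⇒¬pendantAt {a} {x} 2≤deg with pendantAt G a x in pendant
    ... | false = refl
    ... | true  = ⊥-elim (ℕ.<-irrefl (sym (proj₂ (pendantAt-adjacent-leaf pendant))) 2≤deg)

  indicator-∨ : ∀ p q → (p ≡ true → q ≡ true → ⊥) → indicator (p ∨ q) ≡ indicator p + indicator q
  indicator-∨ true  true  disjoint = ⊥-elim (disjoint refl refl)
  indicator-∨ true  false _        = refl
  indicator-∨ false q     _        = refl

  indicator-split : ∀ p q → (q ≡ true → p ≡ true) → indicator p ≡ indicator (p ∧ not q) + indicator q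
  indicator-split true  true  _     = refl
  indicator-split true  false _     = refl
  indicator-split false false _     = refl
  indicator-split false true  q⇒p with q⇒p refl
  ... | ()

  module _ {n : ℕ} {G G' : Graph n} {u : Fin n} (same-adjacency : ∀ y → G' u y ≡ G u y) where

    M-change-at : ∀ p → (∀ y → y ≢ p → G u y ≡ true → deg G' y ≡ deg G y) →
                  let R = ℕ*.sum (ℕ*.erase (neighbourFactor G u) p) in
                  M G u ≡ neighbourFactor G u p * R × M G' u ≡ neighbourFactor G' u p * R
    M-change-at p unchanged =
      trans (M-product G u) (ℕ*.sum-erase _ p) ,
      trans (M-product G' u)
        (trans (ℕ*.sum-erase _ p) (cong (neighbourFactor G' u p *_) (ℕ*.sum-cong-≗ same-erased)))
      where
      same-factor : ∀ y → y ≢ p → neighbourFactor G' u y ≡ neighbourFactor G u y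
      same-factor y y≢p rewrite same-adjacency y with G u y in uy
      ... | true  = unchanged y y≢p uy
      ... | false = refl
      same-erased : ∀ y → ℕ*.erase (neighbourFactor G' u) p y ≡ ℕ*.erase (neighbourFactor G u) p y
      same-erased y with y Fin.≟ p
      ... | yes refl = trans (updateAt-updates p _) (sym (updateAt-updates p _))
      ... | no y≢p   = trans (ℕ*.erase-≢ _ y≢p) (trans (same-factor y y≢p) (sym (ℕ*.erase-≢ _ y≢p)))

module DiametralPaths where

  open import Defs
  open Walks
  open TreeWalks
  open GraphInvariants
  open import Data.Bool using (true; false)
  open import Data.Empty using (⊥-elim)
  open import Data.Fin as Fin using (Fin)
  open import Data.Nat as ℕ using (ℕ; zero; suc; _+_; _∸_; _⊔_; _≤_; _<_; z≤n; s≤s)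
  open import Data.Nat.Properties
  open import Data.Product using (_,_)
  open import Data.Sum using (_⊎_; inj₁; inj₂)
  open import Function using (_∘_)
  open import Relation.Binary.PropositionalEquality
  open import Relation.Nullary using (yes; no)

  module DiametralPath {n : ℕ} {T : Graph n} (tree : IsTree T) (D : ℕ) (v : ℕ → Fin n)
                       (D≡diameter : D ≡ diameter T) (path : IsWalk T D v) (v-dist : dist T (v 0) (v D) ≡ D) where

    open IsTree tree
    open Tree tree

    dist-≤-D : ∀ x y → dist T x y ≤ D
    dist-≤-D x y = ≤-trans (dist-≤-ecc T x y) (subst (ecc T x ≤_) (sym D≡diameter) (ecc-≤-diameter T x))

    path-nonBacktracking : NonBacktracking T D v
    path-nonBacktracking j 2+j≤D back with cut-backtrack T D j path 2+j≤D back
    ... | (L , L<D , w , w0 , wL , walk) =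
      <-irrefl refl (≤-<-trans (subst (_≤ L) (trans (cong₂ (dist T) w0 wL) v-dist) (dist-≤-length T L w walk)) L<D)

    path-injective : ∀ i j → i ≤ D → j ≤ D → v i ≡ v j → i ≡ j
    path-injective = NonBacktrackingWalk.injective D v path path-nonBacktracking

    path-≢ : ∀ i j → i ≤ D → j ≤ D → i ≢ j → v i ≢ v j
    path-≢ i j i≤D j≤D i≢j = i≢j ∘ path-injective i j i≤D j≤D

    segment-walk : ∀ i k → i + k ≤ D → IsWalk T k (drop i v)
    segment-walk i k i+k≤D = drop-walk T i k (IsWalk-≤ T i+k≤D path)

    segment-nonBacktracking : ∀ i k → i + k ≤ D → NonBacktracking T k (drop i v)
    segment-nonBacktracking i k i+k≤D = drop-nonBacktracking T i k (NonBacktracking-≤ T i+k≤D path-nonBacktracking)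

    segment-dist : ∀ i k → i + k ≤ D → dist T (v i) (v (i + k)) ≡ k
    segment-dist i k i+k≤D = nonBacktracking-dist k
      (drop i v , cong v (+-identityʳ i) , refl , segment-walk i k i+k≤D , segment-nonBacktracking i k i+k≤D)

    path-nonadjacent : ∀ i k → i + (2 + k) ≤ D → T (v i) (v (i + (2 + k))) ≡ false
    path-nonadjacent i k i+2+k≤D with T (v i) (v (i + (2 + k))) in adjacent
    ... | false = refl
    ... | true  = ⊥-elim (<-irrefl refl (<-≤-trans (s≤s (s≤s z≤n))
            (subst (_≤ 1) (segment-dist i (2 + k) i+2+k≤D) (dist-≤-length T 1 _ (edge-walk T adjacent)))))

    prefix-reversed-walk : ∀ k → k ≤ D → IsWalk T k (reverse k v)
    prefix-reversed-walk k k≤D = reverse-walk T symmetric k (IsWalk-≤ T k≤D path)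

    prefix-reversed-nonBacktracking : ∀ k → k ≤ D → NonBacktracking T k (reverse k v)
    prefix-reversed-nonBacktracking k k≤D = reverse-nonBacktracking T k (NonBacktracking-≤ T k≤D path-nonBacktracking)

    -- Prolonging p along the path in a direction other than the one p arrives from keeps it non-backtracking.
    extend-along-path : ∀ i → suc i < D → ∀ L p → IsWalk T L p → NonBacktracking T L p → p L ≡ v (suc i) →
                        dist T (p 0) (v 0) ≡ L + suc i ⊎ dist T (p 0) (v D) ≡ L + (D ∸ suc i)
    extend-along-path i 1+i<D zero p _ _ pL =
      inj₁ (nonBacktracking-dist (suc i) (reverse (suc i) v , sym pL , cong v (n∸n≡0 i) ,
        prefix-reversed-walk (suc i) (<⇒≤ 1+i<D) , prefix-reversed-nonBacktracking (suc i) (<⇒≤ 1+i<D)))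
    extend-along-path i 1+i<D (suc L) p walk nb pL with p L Fin.≟ v i
    ... | no pL≢vi =
      inj₁ (nonBacktracking-dist (suc L + suc i)
        (append (suc L) p q , append-≤ (suc L) p q z≤n , trans (append-+ (suc L) p q (suc i) pL) (cong v (n∸n≡0 i)) ,
         append-walk T (suc L) (suc i) walk (prefix-reversed-walk (suc i) (<⇒≤ 1+i<D)) pL ,
         append-nonBacktracking T L (suc i) nb (prefix-reversed-nonBacktracking (suc i) (<⇒≤ 1+i<D)) pL
           (λ _ pL≡vi → pL≢vi pL≡vi)))
      where
      q = reverse (suc i) v
    ... | yes pL≡vi =
      inj₂ (nonBacktracking-dist (suc L + l)
        (append (suc L) p q , append-≤ (suc L) p q z≤n , trans (append-+ (suc L) p q l meet) (cong v 1+i+l≡D) ,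
         append-walk T (suc L) l walk (segment-walk (suc i) l (≤-reflexive 1+i+l≡D)) meet ,
         append-nonBacktracking T L l nb (segment-nonBacktracking (suc i) l (≤-reflexive 1+i+l≡D)) meet
           (λ _ pL≡vi+2 → path-nonBacktracking i 1+i<D
             (trans (sym pL≡vi) (trans pL≡vi+2 (cong v (cong suc (+-comm i 1))))))))
      where
      l = D ∸ suc i
      1+i+l≡D : suc i + l ≡ D
      1+i+l≡D = m+[n∸m]≡n (<⇒≤ 1+i<D)
      q = drop (suc i) v
      meet : p (suc L) ≡ q 0
      meet = trans pL (cong v (sym (+-identityʳ (suc i))))

    dist-interior : ∀ u i → suc i < D →
                    dist T u (v 0) ≡ dist T u (v (suc i)) + suc i ⊎
                    dist T u (v D) ≡ dist T u (v (suc i)) + (D ∸ suc i)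
    dist-interior u i 1+i<D with geodesic u (v (suc i))
    ... | (p , refl , pL , walk , nb) = extend-along-path i 1+i<D _ p walk nb pL

    dist-interior-≤ : ∀ x i → suc i < D → dist T (v (suc i)) x ≤ (D ∸ suc i) ⊔ suc i
    dist-interior-≤ x i 1+i<D rewrite dist-sym (v (suc i)) x with dist-interior x i 1+i<D
    ... | inj₁ via-v₀ = ≤-trans (+-cancelʳ-≤ (suc i) _ _ (begin
        d + suc i            ≡⟨ sym via-v₀ ⟩
        dist T x (v 0)       ≤⟨ dist-≤-D x (v 0) ⟩
        D                    ≡⟨ sym (m∸n+n≡m (<⇒≤ 1+i<D)) ⟩
        (D ∸ suc i) + suc i  ∎)) (m≤m⊔n _ _)
      where
      open ≤-Reasoning
      d = dist T x (v (suc i))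
    ... | inj₂ via-v-D = ≤-trans (+-cancelʳ-≤ (D ∸ suc i) _ _ (begin
        d + (D ∸ suc i)      ≡⟨ sym via-v-D ⟩
        dist T x (v D)       ≤⟨ dist-≤-D x (v D) ⟩
        D                    ≡⟨ sym (m+[n∸m]≡n (<⇒≤ 1+i<D)) ⟩
        suc i + (D ∸ suc i)  ∎)) (m≤n⊔m _ _)
      where
      open ≤-Reasoning
      d = dist T x (v (suc i))

    dist-interior-< : ∀ u i → suc i < D → dist T u (v (suc i)) < ecc T u
    dist-interior-< u i 1+i<D with dist-interior u i 1+i<D
    ... | inj₁ via-v₀ =
      <-≤-trans (m<m+n _ (s≤s z≤n)) (subst (_≤ ecc T u) via-v₀ (dist-≤-ecc T u (v 0)))
    ... | inj₂ via-v-D =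
      <-≤-trans (m<m+n _ (m<n⇒0<n∸m 1+i<D)) (subst (_≤ ecc T u) via-v-D (dist-≤-ecc T u (v D)))

    -- Otherwise y x v₁ v₂ … v_D would be a non-backtracking walk longer than the diameter.
    off-path-neighbour-is-leaf : 0 < D → ∀ {x} → T (v 1) x ≡ true → x ≢ v 2 → ∀ y → T x y ≡ true → y ≡ v 1
    off-path-neighbour-is-leaf 0<D {x} v₁x x≢v₂ y xy with y Fin.≟ v 1
    ... | yes y≡v₁ = y≡v₁
    ... | no y≢v₁ = ⊥-elim (<-irrefl refl (<-≤-trans (n<1+n D)
            (subst (_≤ D) (nonBacktracking-dist (suc D) (w , refl , ends-at-v-D D 0<D , walk , nb))
                          (dist-≤-D y (v D)))))
      where
      w : ℕ → Fin n
      w zero          = y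
      w (suc zero)    = x
      w (suc (suc t)) = v (suc t)
      ends-at-v-D : ∀ m → 0 < m → w (suc m) ≡ v m
      ends-at-v-D (suc m) _ = refl
      walk : IsWalk T (suc D) w
      walk zero          _             = trans (symmetric y x) xy
      walk (suc zero)    _             = trans (symmetric x (v 1)) v₁x
      walk (suc (suc j)) (s≤s 2+j≤D) = path (suc j) 2+j≤D
      nb : NonBacktracking T (suc D) w
      nb zero          _       = y≢v₁
      nb (suc zero)    _       = x≢v₂
      nb (suc (suc j)) 4+j≤1+D = path-nonBacktracking (suc j) (≤-pred 4+j≤1+D)

    off-path-neighbour-is-pendant : 0 < D → ∀ {x} → T (v 1) x ≡ true → x ≢ v 2 → pendantAt T (v 1) x ≡ true
    off-path-neighbour-is-pendant 0<D {x} v₁x x≢v₂ rewrite v₁x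
      | deg-single-neighbour T (trans (symmetric x (v 1)) v₁x) (off-path-neighbour-is-leaf 0<D v₁x x≢v₂) = refl

    interior-2≤deg : ∀ i → suc i < D → 2 ≤ deg T (v (suc i))
    interior-2≤deg i 1+i<D =
      two-neighbours⇒2≤deg T (trans (symmetric _ _) (path i (<-trans (n<1+n i) 1+i<D))) (path (suc i) 1+i<D)
        (path-≢ i (2 + i) (≤-trans (n≤1+n i) (<⇒≤ 1+i<D)) 1+i<D (λ ()))

    interior-¬pendant : ∀ {a} i → suc i < D → pendantAt T a (v (suc i)) ≡ false
    interior-¬pendant i 1+i<D = 2≤deg⇒¬pendantAt T (interior-2≤deg i 1+i<D)

module Transfer where

  open import Defs
  open FiniteSums
  open Walks
  open TreeWalks
  open GraphInvariants
  open Fractions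
  open DiametralPaths
  open import Data.Bool using (Bool; true; false; _∧_; _∨_; not; if_then_else_)
  open import Data.Bool.Properties using (∧-zeroʳ; ∧-identityʳ; ∨-identityʳ; ∨-zeroʳ)
  open import Data.Empty using (⊥-elim)
  open import Data.Fin as Fin using (Fin)
  open import Data.Nat as ℕ using (ℕ; zero; suc; _+_; _*_; _≤_; _<_; z≤n; s≤s)
  open import Data.Nat.Properties
  open import Data.Rational as ℚ using (ℚ)
  import Data.Rational.Properties as ℚ
  open import Data.Product using (_×_; _,_; proj₁; proj₂)
  open import Data.Sum using (inj₁; inj₂)
  open import Relation.Binary.PropositionalEquality
  open import Relation.Nullary using (Dec; yes; no)
  open import Relation.Nullary.Decidable using (⌊_⌋)
  open import Function using (_∘_)

  module PendantTransfer {n : ℕ} {T : Graph n} (tree : IsTree T) (e : ℕ) (v : ℕ → Fin n)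
                         (D≡diameter : 5 + e ≡ diameter T) (path : IsWalk T (5 + e) v)
                         (v-dist : dist T (v 0) (v (5 + e)) ≡ 5 + e) where

    open IsTree tree
    open Tree tree
    open DiametralPath tree (5 + e) v D≡diameter path v-dist

    a b c : Fin n
    a = v 1
    b = v (4 + e)
    c = v (3 + e)

    pendant : Fin n → Bool
    pendant = pendantAt T a

    T' : Graph n
    T' = move T a b

    v₀-pendant : pendant (v 0) ≡ true
    v₀-pendant = off-path-neighbour-is-pendant (s≤s z≤n) (trans (symmetric _ _) (path 0 (s≤s z≤n)))
                   (path-≢ 0 2 z≤n (s≤s (s≤s z≤n)) (λ ()))

    a-¬pendant : pendant a ≡ false
    a-¬pendant = interior-¬pendant 0 (s≤s (s≤s z≤n))

    b-¬pendant : pendant b ≡ false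
    b-¬pendant = interior-¬pendant (3 + e) ≤-refl

    c-¬pendant : pendant c ≡ false
    c-¬pendant = interior-¬pendant (2 + e) (s≤s (s≤s (s≤s (s≤s (n≤1+n _)))))

    v₂-¬pendant : pendant (v 2) ≡ false
    v₂-¬pendant = interior-¬pendant 1 (s≤s (s≤s (s≤s z≤n)))

    pendant-neighbour : ∀ {w y} → pendant w ≡ true → T w y ≡ true → y ≡ a
    pendant-neighbour = pendantAt-neighbour T symmetric

    pendant-≢ : ∀ {x y} → pendant x ≡ true → pendant y ≡ false → x ≢ y
    pendant-≢ x-p y-np refl = true≢false (trans (sym x-p) y-np)

    a≢b : a ≢ b
    a≢b = path-≢ 1 (4 + e) (s≤s z≤n) (n≤1+n _) (λ ())

    v₂≢a : v 2 ≢ a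
    v₂≢a = path-≢ 2 1 (s≤s (s≤s z≤n)) (s≤s z≤n) (λ ())

    v₂≢b : v 2 ≢ b
    v₂≢b = path-≢ 2 (4 + e) (s≤s (s≤s z≤n)) (n≤1+n _) (λ ())

    c≢a : c ≢ a
    c≢a = path-≢ (3 + e) 1 (m≤n+m _ 2) (s≤s z≤n) (λ ())

    c≢b : c ≢ b
    c≢b = path-≢ (3 + e) (4 + e) (m≤n+m _ 2) (n≤1+n _) (λ 3+e≡4+e → <-irrefl 3+e≡4+e (n<1+n _))

    v₂≢c : v 2 ≢ c
    v₂≢c = path-≢ 2 (3 + e) (s≤s (s≤s z≤n)) (m≤n+m _ 2) (λ ())

    v₀≢v₂ : v 0 ≢ v 2
    v₀≢v₂ = path-≢ 0 2 z≤n (s≤s (s≤s z≤n)) (λ ())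

    v₀≢c : v 0 ≢ c
    v₀≢c = path-≢ 0 (3 + e) z≤n (m≤n+m _ 2) (λ ())

    v₀≢v-D : v 0 ≢ v (5 + e)
    v₀≢v-D = path-≢ 0 (5 + e) z≤n ≤-refl (λ ())

    T-v₂a : T (v 2) a ≡ true
    T-v₂a = trans (symmetric _ _) (path 1 (s≤s (s≤s z≤n)))

    T-cb : T c b ≡ true
    T-cb = path (3 + e) (s≤s (s≤s (s≤s (s≤s (n≤1+n e)))))

    move-other : ∀ {x} → x ≢ a → x ≢ b → pendant x ≡ false → ∀ y → T' x y ≡ T x y
    move-other {x} x≢a x≢b x-np y rewrite ≟-≢ x≢a | ≟-≢ x≢b | x-np
      | ∧-zeroʳ ⌊ y Fin.≟ a ⌋ | ∧-zeroʳ ⌊ y Fin.≟ b ⌋ = trans (∨-identityʳ _) (∧-identityʳ _)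

    move-a : ∀ y → T' a y ≡ T a y ∧ not (pendant y)
    move-a y rewrite ≟-refl a | ≟-≢ a≢b | a-¬pendant
      | ∧-zeroʳ ⌊ y Fin.≟ a ⌋ | ∧-zeroʳ ⌊ y Fin.≟ b ⌋ | ∨-identityʳ (pendant y) = ∨-identityʳ _

    move-b : ∀ y → T' b y ≡ T b y ∨ pendant y
    move-b y rewrite ≟-≢ (a≢b ∘ sym) | ≟-refl b | b-¬pendant
      | ∧-zeroʳ ⌊ y Fin.≟ a ⌋ | ∧-zeroʳ ⌊ y Fin.≟ b ⌋ | ∧-identityʳ (T b y) | ∨-identityʳ (pendant y) = refl

    move-pendant : ∀ {w} → pendant w ≡ true → ∀ y → T' w y ≡ ⌊ y Fin.≟ b ⌋
    move-pendant {w} w-p y rewrite ≟-≢ (pendant-≢ w-p a-¬pendant) | ≟-≢ (pendant-≢ w-p b-¬pendant) | w-p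
      | ∧-identityʳ ⌊ y Fin.≟ a ⌋ | ∧-identityʳ ⌊ y Fin.≟ b ⌋ = cong (_∨ ⌊ y Fin.≟ b ⌋) not-to-a
      where
      not-to-a : T w y ∧ not ⌊ y Fin.≟ a ⌋ ≡ false
      not-to-a with y Fin.≟ a
      ... | yes _ = ∧-zeroʳ (T w y)
      ... | no y≢a with T w y in wy
      ...   | true  = ⊥-elim (y≢a (pendant-neighbour w-p wy))
      ...   | false = refl

    move-nonpendant : ∀ {x y} → pendant x ≡ false → pendant y ≡ false → T' x y ≡ T x y
    move-nonpendant {x} {y} x-np y-np = by-cases (x Fin.≟ a) (x Fin.≟ b)
      where
      by-cases : Dec (x ≡ a) → Dec (x ≡ b) → T' x y ≡ T x y
      by-cases (yes refl) _          rewrite move-a y | y-np = ∧-identityʳ (T a y)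
      by-cases (no _)     (yes refl) rewrite move-b y | y-np = ∨-identityʳ (T b y)
      by-cases (no x≢a)   (no x≢b)   = move-other x≢a x≢b x-np y

    moved-pendant-b : ∀ {w} → pendant w ≡ true → T' w b ≡ true
    moved-pendant-b w-p = trans (move-pendant w-p b) (≟-refl b)

    moved-pendant-neighbour : ∀ {w y} → pendant w ≡ true → T' w y ≡ true → y ≡ b
    moved-pendant-neighbour {y = y} w-p wy = ≟⇒≡ (trans (sym (move-pendant w-p y)) wy)

    moved-a-neighbour : ∀ {y} → T' a y ≡ true → y ≡ v 2
    moved-a-neighbour {y} ay = by-cases (T a y) (pendant y) refl refl (trans (sym (move-a y)) ay)
      where
      by-cases : ∀ p q → T a y ≡ p → pendant y ≡ q → p ∧ not q ≡ true → y ≡ v 2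
      by-cases true  true  _    _    ()
      by-cases false _     _    _    ()
      by-cases true  false T-ay y-np _ with y Fin.≟ v 2
      ... | yes y≡v₂ = y≡v₂
      ... | no y≢v₂  = ⊥-elim (pendant-≢ (off-path-neighbour-is-pendant (s≤s z≤n) T-ay y≢v₂) y-np refl)

    moved-a-v₂ : T' a (v 2) ≡ true
    moved-a-v₂ = trans (move-a (v 2)) (cong₂ (λ p q → p ∧ not q) (path 1 (s≤s (s≤s z≤n))) v₂-¬pendant)

    neighbour-≢ : ∀ {x y} → T x y ≡ true → y ≢ x
    neighbour-≢ {x} xy refl = true≢false (trans (sym xy) (irreflexive x))

    neighbour-¬pendant : ∀ {u y} → u ≢ a → T u y ≡ true → pendant y ≡ false
    neighbour-¬pendant {u} {y} u≢a uy with pendant y in y-p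
    ... | false = refl
    ... | true  = ⊥-elim (u≢a (pendant-neighbour y-p (trans (symmetric y u) uy)))

    neighbour-≢a : ∀ {u y} → u ≢ v 2 → pendant u ≡ false → T u y ≡ true → y ≢ a
    neighbour-≢a {u} u≢v₂ u-np uy refl =
      pendant-≢ (off-path-neighbour-is-pendant (s≤s z≤n) (trans (symmetric a u) uy) u≢v₂) u-np refl

    K : ℕ
    K = ℕ+.sum (indicator ∘ pendant)

    deg-moved-pendant : ∀ {w} → pendant w ≡ true → deg T' w ≡ 1
    deg-moved-pendant w-p = deg-single-neighbour T' (moved-pendant-b w-p) (λ _ → moved-pendant-neighbour w-p)

    deg-moved-a : deg T' a ≡ 1
    deg-moved-a = deg-single-neighbour T' moved-a-v₂ (λ _ → moved-a-neighbour)

    deg-a : deg T a ≡ 1 + K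
    deg-a = begin
      deg T a                                           ≡⟨ deg-sum T a ⟩
      ℕ+.sum (indicator ∘ T a)                          ≡⟨ ℕ+.sum-cong-≗ split ⟩
      ℕ+.sum (λ y → indicator (kept y) + indicator (pendant y))
                                                        ≡⟨ ℕ+.∑-distrib-+ (indicator ∘ kept) (indicator ∘ pendant) ⟩
      ℕ+.sum (indicator ∘ kept) + K                     ≡⟨ cong (_+ K) (ℕ+.sum-cong-≗ (cong indicator ∘ sym ∘ move-a)) ⟩
      ℕ+.sum (indicator ∘ T' a) + K                     ≡⟨ cong (_+ K) (trans (sym (deg-sum T' a)) deg-moved-a) ⟩
      1 + K                                             ∎
      where
      open ≡-Reasoning
      kept : Fin n → Bool
      kept y = T a y ∧ not (pendant y)
      split : ∀ y → indicator (T a y) ≡ indicator (kept y) + indicator (pendant y)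
      split y = indicator-split (T a y) (pendant y) (proj₁ ∘ pendantAt-adjacent-leaf T)

    deg-moved-b : deg T' b ≡ deg T b + K
    deg-moved-b = begin
      deg T' b                                            ≡⟨ deg-sum T' b ⟩
      ℕ+.sum (indicator ∘ T' b)                           ≡⟨ ℕ+.sum-cong-≗ (cong indicator ∘ move-b) ⟩
      ℕ+.sum (λ y → indicator (T b y ∨ pendant y))        ≡⟨ ℕ+.sum-cong-≗ split ⟩
      ℕ+.sum (λ y → indicator (T b y) + indicator (pendant y))
                                                          ≡⟨ ℕ+.∑-distrib-+ (indicator ∘ T b) (indicator ∘ pendant) ⟩
      ℕ+.sum (indicator ∘ T b) + K                        ≡⟨ cong (_+ K) (sym (deg-sum T b)) ⟩
      deg T b + K                                         ∎
      where
      open ≡-Reasoning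
      split : ∀ y → indicator (T b y ∨ pendant y) ≡ indicator (T b y) + indicator (pendant y)
      split y = indicator-∨ (T b y) (pendant y)
                  (λ by y-p → a≢b (sym (pendant-neighbour y-p (trans (symmetric y b) by))))

    deg-moved-other : ∀ {x} → x ≢ a → x ≢ b → pendant x ≡ false → deg T' x ≡ deg T x
    deg-moved-other x≢a x≢b x-np =
      trans (deg-sum T' _) (trans (ℕ+.sum-cong-≗ (cong indicator ∘ move-other x≢a x≢b x-np)) (sym (deg-sum T _)))

    deg-moved-monotone : ∀ {x} → x ≢ a → deg T x ≤ deg T' x
    deg-moved-monotone {x} x≢a = by-cases (x Fin.≟ b) (pendant x) refl
      where
      by-cases : Dec (x ≡ b) → ∀ p → pendant x ≡ p → deg T x ≤ deg T' x
      by-cases (yes refl) _     _    = subst (deg T b ≤_) (sym deg-moved-b) (m≤m+n _ _)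
      by-cases (no _)     true  x-p  =
        ≤-reflexive (trans (proj₂ (pendantAt-adjacent-leaf T x-p)) (sym (deg-moved-pendant x-p)))
      by-cases (no x≢b)   false x-np = ≤-reflexive (sym (deg-moved-other x≢a x≢b x-np))

    2≤deg-b : 2 ≤ deg T b
    2≤deg-b = interior-2≤deg (3 + e) ≤-refl

    M-pendant : ∀ {w} → pendant w ≡ true → M T w ≡ deg T a × M T' w ≡ deg T' b
    M-pendant w-p =
      M-single-neighbour T (trans (symmetric _ a) (proj₁ (pendantAt-adjacent-leaf T w-p)))
                           (λ _ → pendant-neighbour w-p) ,
      M-single-neighbour T' (moved-pendant-b w-p) (λ _ → moved-pendant-neighbour w-p)

    M-pendant-< : ∀ {w} → pendant w ≡ true → M T w < M T' w
    M-pendant-< w-p = subst₂ _<_ (sym (trans (proj₁ (M-pendant w-p)) deg-a))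
                                 (sym (trans (proj₂ (M-pendant w-p)) deg-moved-b))
                                 (+-monoˡ-≤ K 2≤deg-b)

    Q R : ℕ
    Q = ℕ*.sum (ℕ*.erase (neighbourFactor T (v 2)) a)
    R = ℕ*.sum (ℕ*.erase (neighbourFactor T c) b)

    M-v₂ : M T (v 2) ≡ deg T a * Q × M T' (v 2) ≡ 1 * Q
    M-v₂ = trans (proj₁ split) (cong (_* Q) (neighbourFactor-adjacent T T-v₂a)) ,
           trans (proj₂ split) (cong (_* Q) (trans (neighbourFactor-adjacent T' T'-v₂a) deg-moved-a))
      where
      T'-v₂a : T' (v 2) a ≡ true
      T'-v₂a = trans (move-other v₂≢a v₂≢b v₂-¬pendant a) T-v₂a
      unchanged : ∀ y → y ≢ a → T (v 2) y ≡ true → deg T' y ≡ deg T y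
      unchanged y y≢a v₂y = deg-moved-other y≢a y≢b (neighbour-¬pendant v₂≢a v₂y)
        where
        y≢b : y ≢ b
        y≢b refl = true≢false (trans (sym v₂y) (path-nonadjacent 2 e (n≤1+n _)))
      split = M-change-at (move-other v₂≢a v₂≢b v₂-¬pendant) a unchanged

    M-c : M T c ≡ deg T b * R × M T' c ≡ deg T' b * R
    M-c = trans (proj₁ split) (cong (_* R) (neighbourFactor-adjacent T T-cb)) ,
          trans (proj₂ split) (cong (_* R) (neighbourFactor-adjacent T' T'-cb))
      where
      T'-cb : T' c b ≡ true
      T'-cb = trans (move-other c≢a c≢b c-¬pendant b) T-cb
      unchanged : ∀ y → y ≢ b → T c y ≡ true → deg T' y ≡ deg T y
      unchanged y y≢b cy = deg-moved-other y≢a y≢b (neighbour-¬pendant c≢a cy)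
        where
        y≢a : y ≢ a
        y≢a refl = true≢false (trans (sym (trans (symmetric a c) cy)) (path-nonadjacent 1 e (m≤n+m _ 2)))
      split = M-change-at (move-other c≢a c≢b c-¬pendant) b unchanged

    M-monotone : ∀ {u} → u ≢ v 2 → pendant u ≡ false → M T u ≤ M T' u
    M-monotone {u} u≢v₂ u-np = subst₂ _≤_ (sym (M-product T u)) (sym (M-product T' u))
                                      (ℕ*-sum-mono-≤ (λ y → factor-≤ y (u Fin.≟ a) (u Fin.≟ b)))
      where
      factor-≤ : ∀ y → Dec (u ≡ a) → Dec (u ≡ b) → neighbourFactor T u y ≤ neighbourFactor T' u y
      factor-≤ y (yes refl) _ rewrite move-a y = by-cases (T a y) (pendant y) refl refl
        where
        by-cases : ∀ t p → T a y ≡ t → pendant y ≡ p →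
                   (if t then deg T y else 1) ≤ (if t ∧ not p then deg T' y else 1)
        by-cases true  true  _  y-p = ≤-reflexive (proj₂ (pendantAt-adjacent-leaf T y-p))
        by-cases true  false ay _   = deg-moved-monotone (neighbour-≢ ay)
        by-cases false _     _  _   = ≤-refl
      factor-≤ y (no _) (yes refl) rewrite move-b y = by-cases (T b y) (pendant y) refl refl
        where
        by-cases : ∀ t p → T b y ≡ t → pendant y ≡ p →
                   (if t then deg T y else 1) ≤ (if t ∨ p then deg T' y else 1)
        by-cases true  _     by _   = deg-moved-monotone (neighbour-≢a (v₂≢b ∘ sym) b-¬pendant by)
        by-cases false true  _  y-p = ≤-reflexive (sym (deg-moved-pendant y-p))
        by-cases false false _  _   = ≤-refl
      factor-≤ y (no u≢a) (no u≢b) rewrite move-other u≢a u≢b u-np y = by-cases (T u y) refl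
        where
        by-cases : ∀ t → T u y ≡ t → (if t then deg T y else 1) ≤ (if t then deg T' y else 1)
        by-cases true  uy = deg-moved-monotone (neighbour-≢a u≢v₂ u-np uy)
        by-cases false _  = ≤-refl

    M-off-v₂-≤ : ∀ {u} → u ≢ v 2 → M T u ≤ M T' u
    M-off-v₂-≤ {u} u≢v₂ = by-cases (pendant u) refl
      where
      by-cases : ∀ p → pendant u ≡ p → M T u ≤ M T' u
      by-cases true  u-p  = <⇒≤ (M-pendant-< u-p)
      by-cases false u-np = M-monotone u≢v₂ u-np

    ecc-v₂ : ecc T (v 2) ≡ 3 + e
    ecc-v₂ = ≤-antisym
      (ecc-least T (v 2) (λ x → dist-interior-≤ x 1 (s≤s (s≤s (s≤s z≤n)))))
      (subst (_≤ ecc T (v 2)) (segment-dist 2 (3 + e) ≤-refl) (dist-≤-ecc T (v 2) (v (5 + e))))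

    ecc-c : ecc T c ≡ 3 + e
    ecc-c = ≤-antisym
      (ecc-least T c (λ x → ≤-trans (dist-interior-≤ x (2 + e) (s≤s (s≤s (s≤s (s≤s (n≤1+n _))))))
                                    (⊔-lub (≤-trans (m∸n≤m (2 + e) e) (n≤1+n _)) ≤-refl)))
      (subst (_≤ ecc T c) (trans (dist-sym c (v 0)) (segment-dist 0 (3 + e) (m≤n+m _ 2))) (dist-≤-ecc T c (v 0)))

    ecc-b : ecc T b ≤ 4 + e
    ecc-b = ecc-least T b (λ x → ≤-trans (dist-interior-≤ x (3 + e) ≤-refl)
                                         (⊔-lub (≤-trans (m∸n≤m (1 + e) e) (m≤n+m _ 3)) ≤-refl))

    -- A pendant vertex is a leaf, so it cannot occur strictly inside a non-backtracking walk.
    nonBacktracking-moved-walk : ∀ L p → IsWalk T L p → NonBacktracking T L p →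
                                 pendant (p 0) ≡ false → pendant (p L) ≡ false → IsWalk T' L p
    nonBacktracking-moved-walk L p walk nb start end j j<L =
      trans (move-nonpendant (¬pendant j (<⇒≤ j<L)) (¬pendant (suc j) j<L)) (walk j j<L)
      where
      ¬pendant : ∀ j → j ≤ L → pendant (p j) ≡ false
      ¬pendant zero    _   = start
      ¬pendant (suc j) j<L with m≤n⇒m<n∨m≡n j<L
      ... | inj₂ 1+j≡L = subst (λ i → pendant (p i) ≡ false) (sym 1+j≡L) end
      ... | inj₁ 1+j<L with pendant (p (suc j)) in p-p
      ...   | false = refl
      ...   | true  = ⊥-elim (nb j 1+j<L (trans (pendant-neighbour p-p back) (sym (pendant-neighbour p-p forth))))
        where
        back : T (p (suc j)) (p j) ≡ true
        back = trans (symmetric _ _) (walk j (<-trans (n<1+n j) 1+j<L))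
        forth : T (p (suc j)) (p (2 + j)) ≡ true
        forth = walk (suc j) 1+j<L

    geodesic-moved : ∀ {y x} → pendant y ≡ false → pendant x ≡ false → WalkBetween T' y x (dist T y x)
    geodesic-moved {y} {x} y-np x-np with geodesic y x
    ... | (p , p0 , pL , walk , nb) =
      p , p0 , pL , nonBacktracking-moved-walk _ p walk nb (subst (λ z → pendant z ≡ false) (sym p0) y-np)
                                                           (subst (λ z → pendant z ≡ false) (sym pL) x-np)

    moved-to-b : ∀ {x} → pendant x ≡ true → T' b x ≡ true
    moved-to-b {x} x-p = trans (move-b x) (trans (cong (T b x ∨_) x-p) (∨-zeroʳ _))

    dist-moved-≤ : ∀ {y x} → pendant y ≡ false → pendant x ≡ false → dist T' y x ≤ dist T y x
    dist-moved-≤ y-np x-np = dist-≤-walk T' _ (geodesic-moved y-np x-np)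

    dist-moved-to-pendant : ∀ {y x} → pendant y ≡ false → pendant x ≡ true → dist T' y x ≤ dist T y b + 1
    dist-moved-to-pendant y-np x-p =
      dist-≤-walk T' _ (walkBetween-++ T' _ 1 (geodesic-moved y-np b-¬pendant) (walkBetween-edge T' (moved-to-b x-p)))

    ecc-moved-nonpendant : ∀ {u} → pendant u ≡ false → ecc T' u ≤ ecc T u
    ecc-moved-nonpendant {u} u-np = ecc-least T' u (λ x → by-cases x (pendant x) refl)
      where
      by-cases : ∀ x p → pendant x ≡ p → dist T' u x ≤ ecc T u
      by-cases x false x-np = ≤-trans (dist-moved-≤ u-np x-np) (dist-≤-ecc T u x)
      by-cases x true  x-p  = ≤-trans (dist-moved-to-pendant u-np x-p)
                                      (subst (_≤ ecc T u) (+-comm 1 _) (dist-interior-< u (3 + e) ≤-refl))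

    D≤ecc-pendant : ∀ {u} → pendant u ≡ true → 5 + e ≤ ecc T u
    D≤ecc-pendant {u} u-p = subst (_≤ ecc T u) (nonBacktracking-dist (5 + e) (w , refl , refl , walk , nb))
                                                      (dist-≤-ecc T u (v (5 + e)))
      where
      w : ℕ → Fin n
      w zero    = u
      w (suc t) = v (suc t)
      walk : IsWalk T (5 + e) w
      walk zero    _ = trans (symmetric u a) (proj₁ (pendantAt-adjacent-leaf T u-p))
      walk (suc j) j<D = path (suc j) j<D
      nb : NonBacktracking T (5 + e) w
      nb zero    _   = pendant-≢ u-p v₂-¬pendant
      nb (suc j) j<D = path-nonBacktracking (suc j) j<D

    ecc-moved-pendant : ∀ {u} → pendant u ≡ true → ecc T' u ≤ ecc T u
    ecc-moved-pendant {u} u-p = ≤-trans (ecc-least T' u (λ x → by-cases x (pendant x) refl)) (D≤ecc-pendant u-p)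
      where
      ub : WalkBetween T' u b 1
      ub = walkBetween-edge T' (moved-pendant-b u-p)
      by-cases : ∀ x p → pendant x ≡ p → dist T' u x ≤ 5 + e
      by-cases x false x-np = ≤-trans (dist-≤-walk T' _ (walkBetween-++ T' 1 _ ub (geodesic-moved b-¬pendant x-np)))
                                      (s≤s (≤-trans (dist-≤-ecc T b x) ecc-b))
      by-cases x true  x-p  = ≤-trans (dist-≤-walk T' _ (walkBetween-++ T' 1 1 ub (walkBetween-edge T' (moved-to-b x-p))))
                                      (s≤s (s≤s z≤n))

    ecc-moved-≤ : ∀ u → ecc T' u ≤ ecc T u
    ecc-moved-≤ u with pendant u in u-p
    ... | true  = ecc-moved-pendant u-p
    ... | false = ecc-moved-nonpendant u-p

    ecc-moved-positive : ∀ u → 0 < ecc T' u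
    ecc-moved-positive u with u Fin.≟ v 0
    ... | yes refl = <-≤-trans (dist-positive T' v₀≢v-D) (dist-≤-ecc T' u (v (5 + e)))
    ... | no u≢v₀  = <-≤-trans (dist-positive T' u≢v₀) (dist-≤-ecc T' u (v 0))

    M-v₂+M-c-≤ : Q ≤ R → M T (v 2) + M T c ≤ M T' (v 2) + M T' c
    M-v₂+M-c-≤ Q≤R =
      subst₂ _≤_ (sym (cong₂ _+_ (trans (proj₁ M-v₂) (cong (_* Q) deg-a)) (proj₁ M-c)))
                 (sym (cong₂ _+_ (proj₂ M-v₂) (trans (proj₂ M-c) (cong (_* R) deg-moved-b))))
        (shift-weight-≤ K (deg T b) Q≤R)

    Q≤R : frac (M T (v 2)) (deg T a) ℚ.≤ frac (M T c) (deg T b) → Q ≤ R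
    Q≤R ratio≤ = cancel (deg T b) refl 2≤deg-b
      where
      cancel : ∀ B → deg T b ≡ B → 2 ≤ B → Q ≤ R
      cancel (suc B) deg-b≡ _ = frac-cancel-≤ K B Q R
        (subst₂ ℚ._≤_ (cong₂ frac (trans (proj₁ M-v₂) (cong (_* Q) deg-a)) deg-a)
                      (cong₂ frac (trans (proj₁ M-c) (cong (_* R) deg-b≡)) deg-b≡) ratio≤)

    ξac-increases : frac (M T (v 2)) (deg T a) ℚ.≤ frac (M T c) (deg T b) → ξac T ℚ.< ξac T'
    ξac-increases ratio≤ = begin-strict
      ξac T         ≡⟨ foldr-map-allFin ℚ._+_ ℚ.0ℚ f ⟩
      ℚ+.sum f      <⟨ ℚ+-sum-mono-< f g v₂≢c v₀≢v₂ v₀≢c others pair at-v₀ ⟩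
      ℚ+.sum g      ≤⟨ ℚ+-sum-mono-≤ (λ u → frac-antitoneʳ (M T' u) (ecc-moved-positive u) (ecc-moved-≤ u)) ⟩
      ℚ+.sum g'     ≡⟨ sym (foldr-map-allFin ℚ._+_ ℚ.0ℚ g') ⟩
      ξac T'        ∎
      where
      open ℚ.≤-Reasoning
      f g g' : Fin n → ℚ
      f  u = frac (M T u) (ecc T u)
      g  u = frac (M T' u) (ecc T u)
      g' u = frac (M T' u) (ecc T' u)
      others : ∀ u → u ≢ v 2 → u ≢ c → f u ℚ.≤ g u
      others u u≢v₂ _ = frac-monoˡ-≤ (ecc T u) (M-off-v₂-≤ u≢v₂)
      common-denominator : ∀ G → frac (M G (v 2)) (ecc T (v 2)) ℚ.+ frac (M G c) (ecc T c) ≡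
                                 frac (M G (v 2) + M G c) (3 + e)
      common-denominator G =
        trans (cong₂ ℚ._+_ (cong (frac (M G (v 2))) ecc-v₂) (cong (frac (M G c)) ecc-c))
              (sym (frac-+ (M G (v 2)) (M G c) (2 + e)))
      pair : f (v 2) ℚ.+ f c ℚ.≤ g (v 2) ℚ.+ g c
      pair = subst₂ ℚ._≤_ (sym (common-denominator T)) (sym (common-denominator T'))
               (frac-monoˡ-≤ (3 + e) (M-v₂+M-c-≤ (Q≤R ratio≤)))
      at-v₀ : f (v 0) ℚ.< g (v 0)
      at-v₀ = frac-monoˡ-< (<-≤-trans (dist-positive T v₀≢v-D) (dist-≤-ecc T (v 0) (v (5 + e))))
                           (M-pendant-< v₀-pendant)

open import Defs
open import Data.Nat using (ℕ; _≤_; _<_; suc; _∸_; s≤s; z≤n)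
open import Data.Fin using (Fin)
open import Data.Bool using (true)
open import Data.Rational using (_<_; _≤_)
open import Relation.Binary.PropositionalEquality using (_≡_)

theorem4 : ∀ {n : ℕ} (T : Graph n) → IsTree T →
    ∀ (D : ℕ) → D ≡ diameter T → 5 Data.Nat.≤ D →
    ∀ (v : ℕ → Fin n) →
    (∀ i → i Data.Nat.< D → T (v i) (v (suc i)) ≡ true) →
    dist T (v 0) (v D) ≡ D →
    frac (M T (v 2)) (deg T (v 1)) Data.Rational.≤ frac (M T (v (D ∸ 2))) (deg T (v (D ∸ 1))) →
    ξac T Data.Rational.< ξac (move T (v 1) (v (D ∸ 1)))
theorem4 T tree D D≡diameter (s≤s (s≤s (s≤s (s≤s (s≤s z≤n))))) v path v-dist =
  Transfer.PendantTransfer.ξac-increases tree _ v D≡diameter path v-dist
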